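{- Let $X$ be an $(\boldsymbol{\mathcal{S}},\boldsymbol{\mathcal{S}}')$-recognizable subset of $\mathbb{N}^{d+d'}$. Then the sequence $f\colon\mathbb{N}^d\to\mathbb{N}_\infty$, $\boldsymbol{n}\mapsto\mathrm{Card}\{\boldsymbol{n}'\in\mathbb{N}^{d'}:(\boldsymbol{n},\boldsymbol{n}')\in X\}$, is $(\boldsymbol{\mathcal{S}},\mathbb{N}_\infty)$-regular. If moreover $f(\mathbb{N}^d)\subseteq\mathbb{N}$, then $f$ is $(\boldsymbol{\mathcal{S}},\mathbb{N})$-regular.
   Context: An abstract numeration system is a triple $\mathcal{S}=(L,A,<)$ where $L$ is an infinite regular language over a finite alphabet $A$ totally ordered by $<$. Words are ordered by the radix order ($u<_{\rm rad}v$ iff $|u|<|v|$, or $|u|=|v|$ and $u$ is lexicographically smaller); $\mathrm{rep}_{\mathcal{S}}\colon\mathbb{N}\to L$ maps $n$ to the $n$-th word of $L$ (indexing from $0$) and $\mathrm{val}_{\mathcal{S}}$ is its inverse. For $e\ge1$, abstract numeration systems $\mathcal{T}_j=(K_j,B_j,<_j)$ and a symbol $\#\notin\bigcup_jB_j$, the $e$-dimensional system $\boldsymbol{\mathcal{T}}=(\mathcal{T}_1,\dots,\mathcal{T}_e)$ has alphabet $\boldsymbol{B}=\big((B_1\cup\{\#\})\times\cdots\times(B_e\cup\{\#\})\big)\setminus\{(\#,\dots,\#)\}$, numeration language $\boldsymbol{K}$ consisting of the words over $\boldsymbol{B}$ obtained from $(w_1,\dots,w_e)\in K_1\times\cdots\times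 K_e$ by left-padding each $w_j$ with $\#$'s to the maximal length and reading them in parallel, and $\mathrm{rep}_{\boldsymbol{\mathcal{T}}}(n_1,\dots,n_e)$ is the word so obtained from $(\mathrm{rep}_{\mathcal{T}_1}(n_1),\dots,\mathrm{rep}_{\mathcal{T}_e}(n_e))$; this is a bijection $\mathbb{N}^e\to\boldsymbol{K}$ with inverse $\mathrm{val}_{\boldsymbol{\mathcal{T}}}$. A set $X\subseteq\mathbb{N}^e$ is $\boldsymbol{\mathcal{T}}$-recognizable if $\mathrm{rep}_{\boldsymbol{\mathcal{T}}}(X)$ is regular. $\boldsymbol{\mathcal{S}}=(\mathcal{S}_1,\dots,\mathcal{S}_d)$ and $\boldsymbol{\mathcal{S}}'=(\mathcal{S}'_1,\dots,\mathcal{S}'_{d'})$ are fixed systems of dimensions $d,d'$, and $(\boldsymbol{\mathcal{S}},\boldsymbol{\mathcal{S}}')=(\mathcal{S}_1,\dots,\mathcal{S}_d,\mathcal{S}'_1,\dots,\mathcal{S}'_{d'})$. $\mathbb{N}_\infty=\mathbb{N}\cup\{\infty\}$ is the semiring extending $+,\cdot$ of $\mathbb{N}$ by $\infty+n=n+\infty=\infty$, $\infty\cdot n=n\cdot\infty=\infty$ for $n\neq0$, and $\infty\cdot0=0\cdot\infty=0$. For a semiring $\mathbb{K}$, a series $S\colon A^*\to\mathbb{K}$ is $\mathbb{K}$-recognizable if there exist $r\ge1$, a monoid morphism $\mu\colon A^*\to\mathbb{K}^{r\times r}$, $\lambda\in\mathbb{K}^{1\times r}$, $\gamma\in\mathbb{K}^{r\times1}$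 with $(S,w)=\lambda\mu(w)\gamma$ for all $w$. A sequence $f\colon\mathbb{N}^e\to\mathbb{K}$ is $(\boldsymbol{\mathcal{T}},\mathbb{K})$-regular if the series $\sum_{\boldsymbol{w}\in\boldsymbol{K}}f(\mathrm{val}_{\boldsymbol{\mathcal{T}}}(\boldsymbol{w}))\,\boldsymbol{w}$ over $\boldsymbol{B}$ is $\mathbb{K}$-recognizable. -}

module Defs where

open import Level using (0ℓ)
open import Data.Bool using (Bool; true; false; T; _∨_)
open import Data.Nat using (ℕ; zero; suc; _≤_; _<_; _∸_)
open import Data.Fin using (Fin) renaming (zero to fzero; suc to fsuc; _<_ to _<ᶠ_)
open import Data.Maybe using (Maybe; just; nothing; is-just)
open import Data.List using (List; []; _∷_; length; foldl; foldr; map; replicate) renaming (_++_ to _++ˡ_)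
open import Data.List.Membership.Propositional using (_∈_)
open import Data.List.Relation.Unary.Unique.Propositional using (Unique)
open import Data.List.Relation.Binary.Lex.Strict using (Lex-<)
open import Data.Vec using (Vec; lookup)
open import Data.Product using (Σ; _×_; _,_; proj₁)
open import Data.Sum using (_⊎_)
open import Relation.Nullary using (¬_)
open import Relation.Binary.PropositionalEquality using (_≡_)
open import Function.Bundles using (_⇔_)
open import Algebra.Bundles.Raw using (RawSemiring)

FinCard : {A : Set} → (A → Set) → ℕ → Set
FinCard {A} P n =
  Σ (List A) λ xs → (length xs ≡ n) × Unique xs × ((x : A) → P x ⇔ (x ∈ xs))

data ℕ∞ : Set where
  fin : ℕ → ℕ∞
  ∞   : ℕ∞

HasCard : {A : Set} → (A → Set) → ℕ∞ → Set
HasCard P (fin n) = FinCard P n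
HasCard P ∞       = ¬ (Σ ℕ λ n → FinCard P n)

_+∞_ : ℕ∞ → ℕ∞ → ℕ∞
fin m +∞ fin n = fin (m Data.Nat.+ n)
fin m +∞ ∞     = ∞
∞     +∞ _     = ∞

_*∞_ : ℕ∞ → ℕ∞ → ℕ∞
fin zero    *∞ _           = fin zero
fin (suc m) *∞ fin n       = fin (suc m Data.Nat.* n)
fin (suc m) *∞ ∞           = ∞
∞           *∞ fin zero    = fin zero
∞           *∞ fin (suc n) = ∞
∞           *∞ ∞           = ∞

ℕ∞-rawSemiring : RawSemiring 0ℓ 0ℓ
ℕ∞-rawSemiring = record
  { Carrier = ℕ∞ ; _≈_ = _≡_ ; _+_ = _+∞_ ; _*_ = _*∞_
  ; 0# = fin 0 ; 1# = fin 1 }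

ℕ-rawSemiring : RawSemiring 0ℓ 0ℓ
ℕ-rawSemiring = Data.Nat.+-*-rawSemiring

record DFA (A : Set) : Set where
  field
    nstates : ℕ
    start   : Fin nstates
    δ       : Fin nstates → A → Fin nstates
    final   : Fin nstates → Bool

Accepts : {A : Set} → DFA A → List A → Set
Accepts D w = T (DFA.final D (foldl (DFA.δ D) (DFA.start D) w))

IsRegular : {A : Set} → (List A → Set) → Set
IsRegular {A} L = Σ (DFA A) λ D → (w : List A) → L w ⇔ Accepts D w

-- Abstract numeration systems.  The finite totally ordered alphabet is
-- Fin size with its natural order; L is regular (given by a DFA) and
-- infinite.

record ANS : Set where
  field
    size     : ℕ
    dfa      : DFA (Fin size)
    infinite : (n : ℕ) → Σ (List (Fin size)) λ w → Accepts dfa w × n ≤ length w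

Word : ANS → Set
Word S = List (Fin (ANS.size S))

Lang : (S : ANS) → Word S → Set
Lang S = Accepts (ANS.dfa S)

_<rad_ : {k : ℕ} → List (Fin k) → List (Fin k) → Set
u <rad v = (length u < length v) ⊎ ((length u ≡ length v) × Lex-< _≡_ _<ᶠ_ u v)

Rep : (S : ANS) → ℕ → Word S → Set
Rep S n u = Lang S u × FinCard (λ v → Lang S v × (v <rad u)) n

-- is some component different from #  (# is represented by nothing)
anyJust : {e : ℕ} {B : Fin e → Set} → ((j : Fin e) → Maybe (B j)) → Bool
anyJust {zero}  v = false
anyJust {suc e} v = is-just (v fzero) ∨ anyJust (λ j → v (fsuc j))

-- the alphabet  B = ∏ (B_j ∪ {#}) \ {(#,…,#)}
Letter : {e : ℕ} → Vec ANS e → Set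
Letter {e} Ts =
  Σ ((j : Fin e) → Maybe (Fin (ANS.size (lookup Ts j)))) λ v → T (anyJust v)

proj : {e : ℕ} (Ts : Vec ANS e) (j : Fin e) → List (Letter Ts)
     → List (Maybe (Fin (ANS.size (lookup Ts j))))
proj Ts j w = map (λ a → proj₁ a j) w

-- rep_T(n_1,…,n_e) = w : each component of w is the left #-padding of
-- rep_{T_j}(n_j) to length |w| (the maximal length, since letters are
-- never (#,…,#)).
RepT : {e : ℕ} (Ts : Vec ANS e) → Vec ℕ e → List (Letter Ts) → Set
RepT Ts ns w = (j : Fin _) → Σ (Word (lookup Ts j)) λ u →
  (proj Ts j w ≡ replicate (length w ∸ length u) nothing ++ˡ map just u)
  × Rep (lookup Ts j) (lookup ns j) u

Recognizable : {e : ℕ} (Ts : Vec ANS e) → (Vec ℕ e → Set) → Set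
Recognizable Ts X = IsRegular (λ w → Σ (Vec ℕ _) λ ns → RepT Ts ns w × X ns)

module Matrices (R : RawSemiring 0ℓ 0ℓ) where
  open RawSemiring R

  Mat : ℕ → Set
  Mat r = Fin r → Fin r → Carrier

  ∑ : {r : ℕ} → (Fin r → Carrier) → Carrier
  ∑ {zero}  f = 0#
  ∑ {suc r} f = f fzero + ∑ (λ i → f (fsuc i))

  _⊗_ : {r : ℕ} → Mat r → Mat r → Mat r
  (M ⊗ N) i j = ∑ (λ k → M i k * N k j)

  idM : {r : ℕ} → Mat r
  idM {suc r} fzero    fzero    = 1#
  idM {suc r} fzero    (fsuc j) = 0#
  idM {suc r} (fsuc i) fzero    = 0#
  idM {suc r} (fsuc i) (fsuc j) = idM i j

  μ* : {A : Set} {r : ℕ} → (A → Mat r) → List A → Mat r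
  μ* μ w = foldr (λ a M → μ a ⊗ M) idM w

  sandwich : {r : ℕ} → (Fin r → Carrier) → Mat r → (Fin r → Carrier) → Carrier
  sandwich λv M γ = ∑ (λ i → ∑ (λ j → λv i * (M i j * γ j)))

-- f : ℕ^e → K is (T,K)-regular: the series Σ_{w ∈ K} f(val_T w) w is
-- K-recognizable (coefficient f(val w) on words of K, 0 elsewhere).
Regular : (R : RawSemiring 0ℓ 0ℓ) {e : ℕ} (Ts : Vec ANS e)
        → (Vec ℕ e → RawSemiring.Carrier R) → Set
Regular R Ts f =
  Σ ℕ λ r → Σ (Letter Ts → Mat r) λ μ →
  Σ (Fin r → Carrier) λ λv → Σ (Fin r → Carrier) λ γ →
  (w : List (Letter Ts)) →
    ((ns : Vec ℕ _) → RepT Ts ns w → sandwich λv (μ* μ w) γ ≡ f ns)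
    × (¬ (Σ (Vec ℕ _) λ ns → RepT Ts ns w) → sandwich λv (μ* μ w) γ ≡ 0#)
  where open RawSemiring R
        open Matrices R

-- Let D be a DFA for rep(X) over the alphabet of (S, S′). A word of rep(X) whose S-part is z = rep_S(ns)
-- is a prefix u of letters that are blank in the S-components (present when some S′-component is longer
-- than z), followed by z read in parallel with a word ts of S′-columns. Hence, splitting at the state i
-- reached after u, f(ns) = Σᵢ λᵢ · cᵢ(z), where λᵢ ∈ ℕ∞ counts the prefixes leading D to i (infinite iff
-- one of them can be pumped) and cᵢ(z) counts the ts leading from i to acceptance. Now c(z) = μ(z) γ for
-- the ℕ-matrices μ(a)ᵢₖ = #{S′-columns t | δ(i, (a, t)) = k}, so (λ, μ, γ) is an ℕ∞-representation of f,
-- which is 0 off the numeration language. If f is finite, every ∞ in λ only meets cᵢ(z) = 0, so replacing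
-- ∞ by 0 gives an ℕ-representation.

module Submission where

open import Level using (0ℓ)
open import Defs
open import Data.Bool using (Bool; true; false; T; _∨_; if_then_else_)
open import Data.Bool.Properties using (T?; T-irrelevant; T-∨; ∨-assoc)
open import Data.Nat using (ℕ; zero; suc; _≤_; _<_; z≤n; s≤s; _+_; _*_; _∸_; _⊔_; _⊓_; _≤?_; _<?_)
open import Data.Nat.Properties
open import Data.Nat.Induction using (<-rec)
open import Data.Fin using (Fin; toℕ) renaming (zero to fzero; suc to fsuc)
import Data.Fin.Properties as Fin
open import Data.Maybe using (Maybe; just; nothing; is-just)
import Data.Maybe.Properties as Maybe
open import Data.Unit using (⊤; tt)
open import Data.List
  using (List; []; _∷_; [_]; length; map; foldl; filter; deduplicate; cartesianProduct;
         cartesianProductWith; zipWith; take; drop; replicate; allFin)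
  renaming (_++_ to _++ˡ_)
import Data.List.Properties as List
open import Data.List.Membership.Propositional using (_∈_)
open import Data.List.Membership.Propositional.Properties
open import Data.List.Relation.Unary.Any using (Any; here; there; any?; satisfied)
import Data.List.Relation.Unary.Any as Any
open import Data.List.Relation.Unary.Any.Properties using (¬Any[])
open import Data.List.Relation.Unary.All using (All; []; _∷_)
import Data.List.Relation.Unary.All as All
import Data.List.Relation.Unary.All.Properties as All
open import Data.List.Relation.Unary.Unique.Propositional using (Unique; []; _∷_)
import Data.List.Relation.Unary.Unique.Propositional.Properties as Unique
import Data.List.Relation.Unary.Unique.DecPropositional.Properties as DecUnique
open import Data.List.Relation.Binary.Lex.Strict using (<-compare; <-transitive; <-irreflexive; <-decidable)
open import Data.List.Relation.Binary.Pointwise using (Pointwise-≡⇒≡; ≡⇒Pointwise-≡)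
open import Data.Vec using (Vec; []; _∷_; lookup; _++_)
import Data.Vec as Vec
import Data.Vec.Properties as Vec
open import Data.Product using (Σ; _×_; _,_; proj₁; proj₂)
import Data.Product.Properties as Product
open import Data.Sum using (_⊎_; inj₁; inj₂)
import Data.Sum as Sum
open import Data.Empty using (⊥-elim)
open import Relation.Nullary using (¬_; Dec; yes; no; does)
open import Relation.Nullary.Decidable using (_×-dec_; _⊎-dec_)
open import Relation.Unary using (Decidable)
open import Relation.Binary.Definitions using (DecidableEquality; tri<; tri≈; tri>)
open import Relation.Binary.PropositionalEquality
  using (_≡_; _≢_; refl; sym; trans; cong; cong₂; subst; subst₂; isEquivalence; module ≡-Reasoning)
open import Function.Bundles using (_⇔_; mk⇔; Equivalence)
open import Algebra.Bundles.Raw using (RawSemiring)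
open import Algebra.Properties.CommutativeSemigroup +-commutativeSemigroup
  using () renaming (interchange to +-interchange; x∙yz≈y∙xz to +-exchange)

open Equivalence
open Matrices ℕ-rawSemiring using () renaming (∑ to ∑ℕ; μ* to μ*ℕ; idM to idMℕ; Mat to Matℕ)
open Matrices ℕ∞-rawSemiring using () renaming (∑ to ∑∞; μ* to μ*∞; idM to idM∞)

private
  variable
    A B C : Set
    P Q : A → Set
    e d d′ : ℕ

∈-++-∷⁻-≢ : {x y : A} (ys zs : List A) → y ∈ ys ++ˡ x ∷ zs → x ≢ y → y ∈ ys ++ˡ zs
∈-++-∷⁻-≢ []       zs (here refl) x≢y = ⊥-elim (x≢y refl)
∈-++-∷⁻-≢ []       zs (there y∈)  x≢y = y∈
∈-++-∷⁻-≢ (_ ∷ ys) zs (here y≡)   x≢y = here y≡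
∈-++-∷⁻-≢ (_ ∷ ys) zs (there y∈)  x≢y = there (∈-++-∷⁻-≢ ys zs y∈ x≢y)

Unique-⊆⇒length-≤ : {xs ys : List A} → Unique xs → (∀ {x} → x ∈ xs → x ∈ ys) → length xs ≤ length ys
Unique-⊆⇒length-≤ {xs = []}     _          _  = z≤n
Unique-⊆⇒length-≤ {xs = x ∷ xs} (x∉ ∷ !xs) xs⊆ys with ∈-∃++ (xs⊆ys (here refl))
... | ys , zs , refl = subst (suc (length xs) ≤_) (sym length-removed)
  (s≤s (Unique-⊆⇒length-≤ !xs (λ y∈ → ∈-++-∷⁻-≢ ys zs (xs⊆ys (there y∈)) (All.lookup x∉ y∈))))
  where
  open ≡-Reasoning
  length-removed : length (ys ++ˡ x ∷ zs) ≡ suc (length (ys ++ˡ zs))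
  length-removed = begin
    length (ys ++ˡ x ∷ zs)        ≡⟨ List.length-++ ys ⟩
    length ys + suc (length zs)   ≡⟨ +-suc (length ys) (length zs) ⟩
    suc (length ys + length zs)   ≡⟨ cong suc (List.length-++ ys) ⟨
    suc (length (ys ++ˡ zs))      ∎

length-cartesianProduct : (xs : List A) (ys : List B)
                        → length (cartesianProduct xs ys) ≡ length xs * length ys
length-cartesianProduct []       ys = refl
length-cartesianProduct (x ∷ xs) ys =
  trans (List.length-++ (map (x ,_) ys)) (cong₂ _+_ (List.length-map _ ys) (length-cartesianProduct xs ys))

All-preimages : {P : A → Set} {φ : A → B} {ys : List B}
              → All (λ y → Σ A λ x → P x × φ x ≡ y) ys → Σ (List A) λ xs → map φ xs ≡ ys × All P xs
All-preimages []                   = [] , refl , []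
All-preimages ((x , p , refl) ∷ pre) =
  let xs , φxs≡ , ps = All-preimages pre in x ∷ xs , cong (_ ∷_) φxs≡ , p ∷ ps

maxLength : List (List C) → ℕ
maxLength []       = 0
maxLength (w ∷ ws) = length w ⊔ maxLength ws

≤-maxLength : {w : List C} {ws : List (List C)} → w ∈ ws → length w ≤ maxLength ws
≤-maxLength {ws = w ∷ ws}  (here refl) = m≤m⊔n (length w) (maxLength ws)
≤-maxLength {ws = w′ ∷ ws} (Any.there w∈) = ≤-trans (≤-maxLength w∈) (m≤n⊔m (length w′) (maxLength ws))

replicate-++ : (a b : ℕ) {x : B} → replicate a x ++ˡ replicate b x ≡ replicate (a + b) x
replicate-++ zero    b = refl
replicate-++ (suc a) b = cong (_ ∷_) (replicate-++ a b)

map-const : (b : B) (xs : List A) → map (λ _ → b) xs ≡ replicate (length xs) b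
map-const b []       = refl
map-const b (_ ∷ xs) = cong (b ∷_) (map-const b xs)

lookup-injective : (xs ys : Vec A e) → (∀ i → lookup xs i ≡ lookup ys i) → xs ≡ ys
lookup-injective xs ys xs≗ys =
  trans (sym (Vec.tabulate∘lookup xs)) (trans (Vec.tabulate-cong xs≗ys) (Vec.tabulate∘lookup ys))

++-injective-≡length : (xs ys as bs : List A) → length xs ≡ length ys
                     → xs ++ˡ as ≡ ys ++ˡ bs → xs ≡ ys × as ≡ bs
++-injective-≡length []       []       as bs _          eq = refl , eq
++-injective-≡length (x ∷ xs) (y ∷ ys) as bs |xs|≡|ys| eq =
  let xs≡ys , as≡bs = ++-injective-≡length xs ys as bs (suc-injective |xs|≡|ys|) (List.∷-injectiveʳ eq)
  in cong₂ _∷_ (List.∷-injectiveˡ eq) xs≡ys , as≡bs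

-- Cardinalities

FinCard-⊆⇒≤ : {m n : ℕ} → FinCard P m → FinCard Q n → (∀ x → P x → Q x) → m ≤ n
FinCard-⊆⇒≤ (xs , refl , !xs , P⇔xs) (ys , refl , _ , Q⇔ys) P⊆Q =
  Unique-⊆⇒length-≤ !xs (λ {x} x∈ → to (Q⇔ys x) (P⊆Q x (from (P⇔xs x) x∈)))

FinCard-⊂⇒< : {m n : ℕ} → FinCard P m → FinCard Q n → (∀ x → P x → Q x)
            → (x₀ : A) → Q x₀ → ¬ P x₀ → m < n
FinCard-⊂⇒< {P = P} (xs , refl , !xs , P⇔xs) (ys , refl , _ , Q⇔ys) P⊆Q x₀ Qx₀ ¬Px₀ =
  Unique-⊆⇒length-≤ (All.tabulate x₀∉xs ∷ !xs)
    (λ { (here refl) → to (Q⇔ys x₀) Qx₀ ; (there x∈) → to (Q⇔ys _) (P⊆Q _ (from (P⇔xs _) x∈)) })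
  where
  x₀∉xs : ∀ {x} → x ∈ xs → x₀ ≢ x
  x₀∉xs x∈ refl = ¬Px₀ (from (P⇔xs x₀) x∈)

FinCard-unique : {m n : ℕ} → FinCard P m → FinCard P n → m ≡ n
FinCard-unique c c′ = ≤-antisym (FinCard-⊆⇒≤ c c′ (λ _ p → p)) (FinCard-⊆⇒≤ c′ c (λ _ p → p))

HasCard-unique : {a b : ℕ∞} → HasCard P a → HasCard P b → a ≡ b
HasCard-unique {a = fin m} {fin n} c c′ = cong fin (FinCard-unique c c′)
HasCard-unique {a = fin m} {∞}     c c′ = ⊥-elim (c′ (m , c))
HasCard-unique {a = ∞}     {fin n} c c′ = ⊥-elim (c (n , c′))
HasCard-unique {a = ∞}     {∞}     c c′ = refl

FinCard-resp-⇔ : {n : ℕ} → (∀ x → P x ⇔ Q x) → FinCard P n → FinCard Q n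
FinCard-resp-⇔ P⇔Q (xs , len , !xs , P⇔xs) =
  xs , len , !xs ,
  λ x → mk⇔ (λ q → to (P⇔xs x) (from (P⇔Q x) q)) (λ x∈ → to (P⇔Q x) (from (P⇔xs x) x∈))

HasCard-resp-⇔ : {a : ℕ∞} → (∀ x → P x ⇔ Q x) → HasCard P a → HasCard Q a
HasCard-resp-⇔ {a = fin n} P⇔Q c           = FinCard-resp-⇔ P⇔Q c
HasCard-resp-⇔ {a = ∞}     P⇔Q c (n , c′) =
  c (n , FinCard-resp-⇔ (λ x → mk⇔ (from (P⇔Q x)) (to (P⇔Q x))) c′)

FinCard-empty : (∀ x → ¬ P x) → FinCard P 0
FinCard-empty ¬P = [] , refl , [] , λ x → mk⇔ (λ p → ⊥-elim (¬P x p)) (λ ())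

FinCard-≡ : (v : A) → FinCard (_≡ v) 1
FinCard-≡ v = v ∷ [] , refl , All.[] ∷ [] , λ y → mk⇔ here (λ { (here y≡v) → y≡v ; (there ()) })

FinCard⇒covered : {n : ℕ} → FinCard P n → Σ (List A) λ xs → ∀ x → P x → x ∈ xs
FinCard⇒covered (xs , _ , _ , P⇔xs) = xs , λ x → to (P⇔xs x)

covered⇒finite : DecidableEquality A → Decidable P → (xs : List A) → (∀ x → P x → x ∈ xs)
               → Σ ℕ (FinCard P)
covered⇒finite _≟_ P? xs P⊆xs =
  length ys , ys , refl , DecUnique.deduplicate-! _≟_ (filter P? xs) ,
  λ x → mk⇔ (λ p → ∈-deduplicate⁺ _≟_ (∈-filter⁺ P? (P⊆xs x p) p))
            (λ x∈ → proj₂ (∈-filter⁻ P? {xs = xs} (∈-deduplicate⁻ _≟_ (filter P? xs) x∈)))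
  where ys = deduplicate _≟_ (filter P? xs)

module _ {A : Set} (_≟_ : DecidableEquality A) where

  HasCard-⊎ : {P Q : A → Set} → Decidable P → Decidable Q → (∀ x → P x → ¬ Q x) → {a b : ℕ∞}
            → HasCard P a → HasCard Q b → HasCard (λ x → P x ⊎ Q x) (a +∞ b)
  HasCard-⊎ P? Q? disj {fin m} {fin n} (xs , refl , !xs , P⇔xs) (ys , refl , !ys , Q⇔ys) =
    xs ++ˡ ys , List.length-++ xs ,
    Unique.++⁺ !xs !ys (λ { (x∈xs , x∈ys) → disj _ (from (P⇔xs _) x∈xs) (from (Q⇔ys _) x∈ys) }) ,
    λ x → mk⇔ (Sum.[ (λ p → ∈-++⁺ˡ (to (P⇔xs x) p)) , (λ q → ∈-++⁺ʳ xs (to (Q⇔ys x) q)) ])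
              (λ x∈ → Sum.map (from (P⇔xs x)) (from (Q⇔ys x)) (∈-++⁻ xs x∈))
  HasCard-⊎ P? Q? disj {fin m} {∞} _ ¬finQ (k , c) =
    ¬finQ (covered⇒finite _≟_ Q? (proj₁ (FinCard⇒covered c))
                                 (λ x q → proj₂ (FinCard⇒covered c) x (inj₂ q)))
  HasCard-⊎ P? Q? disj {∞} ¬finP _ (k , c) =
    ¬finP (covered⇒finite _≟_ P? (proj₁ (FinCard⇒covered c))
                                 (λ x p → proj₂ (FinCard⇒covered c) x (inj₁ p)))

  HasCard-∑ : {r : ℕ} (U : Fin r → A → Set) → (∀ i → Decidable (U i))
            → (∀ i j x → U i x → U j x → i ≡ j) → (a : Fin r → ℕ∞) → (∀ i → HasCard (U i) (a i))
            → HasCard (λ x → Σ (Fin r) λ i → U i x) (∑∞ a)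
  HasCard-∑ {zero}  U U? disj a c = FinCard-empty (λ x → λ ())
  HasCard-∑ {suc r} U U? disj a c =
    HasCard-resp-⇔ (λ x → mk⇔ (Sum.[ (fzero ,_) , (λ (i , u) → fsuc i , u) ])
                              (λ { (fzero , u) → inj₁ u ; (fsuc i , u) → inj₂ (i , u) }))
      (HasCard-⊎ (U? fzero) (λ x → Fin.any? (λ i → U? (fsuc i) x))
        (λ x u₀ (i , uᵢ) → Fin.0≢1+n (disj fzero (fsuc i) x u₀ uᵢ))
        (c fzero)
        (HasCard-∑ (λ i → U (fsuc i)) (λ i → U? (fsuc i))
          (λ i j x uᵢ uⱼ → Fin.suc-injective (disj (fsuc i) (fsuc j) x uᵢ uⱼ))
          (λ i → a (fsuc i)) (λ i → c (fsuc i))))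

fin-*∞ : (m n : ℕ) → fin m *∞ fin n ≡ fin (m * n)
fin-*∞ zero    n = refl
fin-*∞ (suc m) n = refl

HasCard-× : DecidableEquality A → {U : A → Set} {V : B → Set} → Decidable U → {a : ℕ∞} {n : ℕ}
          → HasCard U a → FinCard V n → HasCard (λ p → U (proj₁ p) × V (proj₂ p)) (a *∞ fin n)
HasCard-× _ _ {fin m} (xs , refl , !xs , U⇔xs) (ys , refl , !ys , V⇔ys) =
  subst (HasCard _) (sym (fin-*∞ (length xs) (length ys)))
    (cartesianProduct xs ys , length-cartesianProduct xs ys , Unique.cartesianProduct⁺ !xs !ys ,
     λ (x , y) → mk⇔ (λ (u , v) → ∈-cartesianProduct⁺ (to (U⇔xs x) u) (to (V⇔ys y) v))
       (λ xy∈ → let x∈ , y∈ = ∈-cartesianProduct⁻ xs ys xy∈ in from (U⇔xs x) x∈ , from (V⇔ys y) y∈))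
HasCard-× _ _ {∞} {zero} _ ([] , refl , _ , V⇔[]) =
  FinCard-empty (λ (x , y) (_ , v) → ¬Any[] (to (V⇔[] y) v))
HasCard-× _≟_ U? {∞} {suc n} ¬finU (y₀ ∷ ys , refl , _ , V⇔ys) (k , c) =
  ¬finU (covered⇒finite _≟_ U? (map proj₁ (proj₁ (FinCard⇒covered c)))
    (λ x u → ∈-map⁺ proj₁ (proj₂ (FinCard⇒covered c) (x , y₀) (u , from (V⇔ys y₀) (here refl)))))

HasCard-via-bijection : DecidableEquality B → Decidable Q → (φ : A → B)
  → (∀ x → P x → Q (φ x)) → (∀ x x′ → P x → P x′ → φ x ≡ φ x′ → x ≡ x′)
  → (∀ y → Q y → Σ A λ x → P x × φ x ≡ y)
  → {c : ℕ∞} → HasCard Q c → HasCard P c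
HasCard-via-bijection {P = P} _ _ φ PQ inj surj {fin n} (ys , refl , !ys , Q⇔ys)
  with All-preimages {P = P} {φ = φ} (All.tabulate {xs = ys} (λ {y} y∈ → surj y (from (Q⇔ys y) y∈)))
... | xs , φxs≡ys , Pxs =
  xs , trans (sym (List.length-map φ xs)) (cong length φxs≡ys) ,
  Unique.map⁻ (subst Unique (sym φxs≡ys) !ys) ,
  λ x → mk⇔ (λ p → ∈-φxs⇒∈ x p (subst (φ x ∈_) (sym φxs≡ys) (to (Q⇔ys (φ x)) (PQ x p))))
            (All.lookup Pxs)
  where
  ∈-φxs⇒∈ : ∀ x → P x → φ x ∈ map φ xs → x ∈ xs
  ∈-φxs⇒∈ x p φx∈ with ∈-map⁻ φ φx∈
  ... | x′ , x′∈ , φx≡φx′ = subst (_∈ xs) (sym (inj x x′ p (All.lookup Pxs x′∈) φx≡φx′)) x′∈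
HasCard-via-bijection _≟_ Q? φ PQ inj surj {∞} ¬finQ (k , c) =
  ¬finQ (covered⇒finite _≟_ Q? (map φ (proj₁ (FinCard⇒covered c)))
    (λ y q → let x , p , φx≡y = surj y q
             in subst (_∈ _) φx≡y (∈-map⁺ φ (proj₂ (FinCard⇒covered c) x p))))

-- Finite sums, matrices and ℕ∞

module _ (R : RawSemiring 0ℓ 0ℓ) where
  open RawSemiring R using (Carrier) renaming (_+_ to _⊕_)
  open Matrices R using (∑)

  ∑-cong : {r : ℕ} {f g : Fin r → Carrier} → (∀ k → f k ≡ g k) → ∑ f ≡ ∑ g
  ∑-cong {zero}  f≗g = refl
  ∑-cong {suc r} f≗g = cong₂ _⊕_ (f≗g fzero) (∑-cong (λ k → f≗g (fsuc k)))

∑ℕ-cong : {r : ℕ} {f g : Fin r → ℕ} → (∀ k → f k ≡ g k) → ∑ℕ f ≡ ∑ℕ g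
∑ℕ-cong = ∑-cong ℕ-rawSemiring

∑ℕ-zero : (r : ℕ) → ∑ℕ {r} (λ _ → 0) ≡ 0
∑ℕ-zero zero    = refl
∑ℕ-zero (suc r) = ∑ℕ-zero r

∑ℕ-distrib-+ : {r : ℕ} (f g : Fin r → ℕ) → ∑ℕ (λ k → f k + g k) ≡ ∑ℕ f + ∑ℕ g
∑ℕ-distrib-+ {zero}  f g = refl
∑ℕ-distrib-+ {suc r} f g =
  trans (cong ((f fzero + g fzero) +_) (∑ℕ-distrib-+ (λ k → f (fsuc k)) (λ k → g (fsuc k))))
        (+-interchange (f fzero) (g fzero) _ _)

∑ℕ-*ˡ : {r : ℕ} (a : ℕ) (f : Fin r → ℕ) → ∑ℕ (λ k → a * f k) ≡ a * ∑ℕ f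
∑ℕ-*ˡ {zero}  a f = sym (*-zeroʳ a)
∑ℕ-*ˡ {suc r} a f =
  trans (cong (a * f fzero +_) (∑ℕ-*ˡ a (λ k → f (fsuc k)))) (sym (*-distribˡ-+ a (f fzero) _))

iverson : Bool → ℕ
iverson b = if b then 1 else 0

kronecker : {r : ℕ} → Fin r → Fin r → ℕ
kronecker i j = iverson (does (i Fin.≟ j))

∑-kronecker : {r : ℕ} (i : Fin r) (h : Fin r → ℕ) → ∑ℕ (λ k → kronecker i k * h k) ≡ h i
∑-kronecker {suc r} fzero h = begin
  h fzero + 0 + ∑ℕ (λ k → 0 * h (fsuc k))  ≡⟨ cong₂ _+_ (+-identityʳ (h fzero)) (∑ℕ-zero r) ⟩
  h fzero + 0                              ≡⟨ +-identityʳ (h fzero) ⟩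
  h fzero                                  ∎
  where open ≡-Reasoning
∑-kronecker {suc r} (fsuc i) h = ∑-kronecker i (λ k → h (fsuc k))

∑ˡ : (A → ℕ) → List A → ℕ
∑ˡ f []       = 0
∑ˡ f (x ∷ xs) = f x + ∑ˡ f xs

∑ˡ-cong : {f g : A → ℕ} (xs : List A) → (∀ x → f x ≡ g x) → ∑ˡ f xs ≡ ∑ˡ g xs
∑ˡ-cong []       f≗g = refl
∑ˡ-cong (x ∷ xs) f≗g = cong₂ _+_ (f≗g x) (∑ˡ-cong xs f≗g)

∑ˡ-++ : (f : A → ℕ) (xs ys : List A) → ∑ˡ f (xs ++ˡ ys) ≡ ∑ˡ f xs + ∑ˡ f ys
∑ˡ-++ f []       ys = refl
∑ˡ-++ f (x ∷ xs) ys = trans (cong (f x +_) (∑ˡ-++ f xs ys)) (sym (+-assoc (f x) _ _))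

∑ˡ-map : (f : B → ℕ) (g : A → B) (xs : List A) → ∑ˡ f (map g xs) ≡ ∑ˡ (λ x → f (g x)) xs
∑ˡ-map f g []       = refl
∑ˡ-map f g (x ∷ xs) = cong (f (g x) +_) (∑ˡ-map f g xs)

∑ˡ-cartesianProductWith : (f : C → ℕ) (g : A → B → C) (xs : List A) (ys : List B)
  → ∑ˡ f (cartesianProductWith g xs ys) ≡ ∑ˡ (λ x → ∑ˡ (λ y → f (g x y)) ys) xs
∑ˡ-cartesianProductWith f g []       ys = refl
∑ˡ-cartesianProductWith f g (x ∷ xs) ys =
  trans (∑ˡ-++ f (map (g x) ys) _) (cong₂ _+_ (∑ˡ-map f (g x) ys) (∑ˡ-cartesianProductWith f g xs ys))

∑ˡ-*ʳ : (f : A → ℕ) (c : ℕ) (xs : List A) → ∑ˡ f xs * c ≡ ∑ˡ (λ x → f x * c) xs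
∑ˡ-*ʳ f c []       = refl
∑ˡ-*ʳ f c (x ∷ xs) = trans (*-distribʳ-+ c (f x) (∑ˡ f xs)) (cong (f x * c +_) (∑ˡ-*ʳ f c xs))

∑-∑ˡ-comm : {r : ℕ} (h : A → Fin r → ℕ) (xs : List A)
          → ∑ℕ (λ k → ∑ˡ (λ x → h x k) xs) ≡ ∑ˡ (λ x → ∑ℕ (h x)) xs
∑-∑ˡ-comm {r = r} h [] = ∑ℕ-zero r
∑-∑ˡ-comm h (x ∷ xs) =
  trans (∑ℕ-distrib-+ (h x) (λ k → ∑ˡ (λ x → h x k) xs)) (cong (∑ℕ (h x) +_) (∑-∑ˡ-comm h xs))

length-filter≡∑ˡ : {P : A → Set} (P? : Decidable P) (xs : List A)
                 → length (filter P? xs) ≡ ∑ˡ (λ x → iverson (does (P? x))) xs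
length-filter≡∑ˡ P? []       = refl
length-filter≡∑ˡ P? (x ∷ xs) with does (P? x)
... | true  = cong suc (length-filter≡∑ˡ P? xs)
... | false = length-filter≡∑ˡ P? xs

idMℕ≡kronecker : {r : ℕ} (i j : Fin r) → idMℕ i j ≡ kronecker i j
idMℕ≡kronecker fzero    fzero    = refl
idMℕ≡kronecker fzero    (fsuc j) = refl
idMℕ≡kronecker (fsuc i) fzero    = refl
idMℕ≡kronecker (fsuc i) (fsuc j) = idMℕ≡kronecker i j

μ*ℕ-unique : {r : ℕ} (ν : A → Matℕ r) (N : List A → Matℕ r)
  → (∀ i j → N [] i j ≡ kronecker i j)
  → (∀ a w i j → N (a ∷ w) i j ≡ ∑ℕ (λ k → ν a i k * N w k j))
  → ∀ w i j → μ*ℕ ν w i j ≡ N w i j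
μ*ℕ-unique ν N N[] N∷ []      i j = trans (idMℕ≡kronecker i j) (sym (N[] i j))
μ*ℕ-unique ν N N[] N∷ (a ∷ w) i j =
  trans (∑ℕ-cong (λ k → cong (ν a i k *_) (μ*ℕ-unique ν N N[] N∷ w k j))) (sym (N∷ a w i j))

∑∞-fin : {r : ℕ} (f : Fin r → ℕ) → ∑∞ (λ k → fin (f k)) ≡ fin (∑ℕ f)
∑∞-fin {zero}  f = refl
∑∞-fin {suc r} f = cong (fin (f fzero) +∞_) (∑∞-fin (λ k → f (fsuc k)))

idM∞-fin : {r : ℕ} (i j : Fin r) → idM∞ i j ≡ fin (idMℕ i j)
idM∞-fin fzero    fzero    = refl
idM∞-fin fzero    (fsuc j) = refl
idM∞-fin (fsuc i) fzero    = refl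
idM∞-fin (fsuc i) (fsuc j) = idM∞-fin i j

μ*∞-fin : {r : ℕ} (ν : A → Matℕ r) (w : List A) (i j : Fin r)
        → μ*∞ (λ a i k → fin (ν a i k)) w i j ≡ fin (μ*ℕ ν w i j)
μ*∞-fin ν []      i j = idM∞-fin i j
μ*∞-fin ν (a ∷ w) i j =
  trans (∑-cong ℕ∞-rawSemiring (λ k → trans (cong (fin (ν a i k) *∞_) (μ*∞-fin ν w k j)) (fin-*∞ _ _)))
        (∑∞-fin (λ k → ν a i k * μ*ℕ ν w k j))

fin-distribˡ : (a : ℕ∞) (x y : ℕ) → (a *∞ fin x) +∞ (a *∞ fin y) ≡ a *∞ fin (x + y)
fin-distribˡ (fin zero)    x       y       = refl
fin-distribˡ (fin (suc m)) x       y       = cong fin (sym (*-distribˡ-+ (suc m) x y))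
fin-distribˡ ∞             zero    zero    = refl
fin-distribˡ ∞             zero    (suc y) = refl
fin-distribˡ ∞             (suc x) y       = refl

∑∞-*fin : {r : ℕ} (a : ℕ∞) (x : Fin r → ℕ) → ∑∞ (λ j → a *∞ fin (x j)) ≡ a *∞ fin (∑ℕ x)
∑∞-*fin {zero}  (fin zero)    x = refl
∑∞-*fin {zero}  (fin (suc m)) x = cong fin (sym (*-zeroʳ m))
∑∞-*fin {zero}  ∞             x = refl
∑∞-*fin {suc r} a             x =
  trans (cong ((a *∞ fin (x fzero)) +∞_) (∑∞-*fin a (λ j → x (fsuc j)))) (fin-distribˡ a (x fzero) _)

sandwich∞-fin : {r : ℕ} (λv : Fin r → ℕ∞) (M : Matℕ r) (γ : Fin r → ℕ)
  → Matrices.sandwich ℕ∞-rawSemiring λv (λ i j → fin (M i j)) (λ j → fin (γ j))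
    ≡ ∑∞ (λ i → λv i *∞ fin (∑ℕ (λ j → M i j * γ j)))
sandwich∞-fin λv M γ = ∑-cong ℕ∞-rawSemiring (λ i →
  trans (∑-cong ℕ∞-rawSemiring (λ j → cong (λv i *∞_) (fin-*∞ (M i j) (γ j))))
        (∑∞-*fin (λv i) (λ j → M i j * γ j)))

sandwichℕ : {r : ℕ} (λv : Fin r → ℕ) (M : Matℕ r) (γ : Fin r → ℕ)
  → Matrices.sandwich ℕ-rawSemiring λv M γ ≡ ∑ℕ (λ i → λv i * ∑ℕ (λ j → M i j * γ j))
sandwichℕ λv M γ = ∑ℕ-cong (λ i → ∑ℕ-*ˡ (λv i) (λ j → M i j * γ j))

-- Sends ∞ to 0; harmless when a sum is finite, since an infinite term then only meets a zero factor.
ℕ∞-truncate : ℕ∞ → ℕ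
ℕ∞-truncate (fin n) = n
ℕ∞-truncate ∞       = 0

+∞≡fin : (x y : ℕ∞) {n : ℕ} → x +∞ y ≡ fin n
       → Σ ℕ λ a → Σ ℕ λ b → x ≡ fin a × y ≡ fin b × a + b ≡ n
+∞≡fin (fin a) (fin b) refl = a , b , refl , refl , refl

*∞fin≡fin : (x : ℕ∞) (c : ℕ) {n : ℕ} → x *∞ fin c ≡ fin n → ℕ∞-truncate x * c ≡ n
*∞fin≡fin (fin zero)    c    refl = refl
*∞fin≡fin (fin (suc m)) c    refl = refl
*∞fin≡fin ∞             zero refl = refl

finite-∑∞⇒∑ℕ-truncate : {r : ℕ} (a : Fin r → ℕ∞) (x : Fin r → ℕ) {n : ℕ}
  → ∑∞ (λ i → a i *∞ fin (x i)) ≡ fin n → ∑ℕ (λ i → ℕ∞-truncate (a i) * x i) ≡ n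
finite-∑∞⇒∑ℕ-truncate {zero}  a x refl = refl
finite-∑∞⇒∑ℕ-truncate {suc r} a x sum≡n =
  let _ , _ , head≡ , rest≡ , +≡ = +∞≡fin (a fzero *∞ fin (x fzero)) _ sum≡n
  in trans (cong₂ _+_ (*∞fin≡fin (a fzero) (x fzero) head≡)
                      (finite-∑∞⇒∑ℕ-truncate (λ i → a (fsuc i)) (λ i → x (fsuc i)) rest≡)) +≡

-- Words and pumping

module Words {C : Set} (letters : List C) (∈-letters : ∀ c → c ∈ letters) where

  wordsOfLength : ℕ → List (List C)
  wordsOfLength zero    = [ [] ]
  wordsOfLength (suc n) = cartesianProductWith _∷_ letters (wordsOfLength n)

  ∈-wordsOfLength : ∀ u → u ∈ wordsOfLength (length u)
  ∈-wordsOfLength []      = here refl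
  ∈-wordsOfLength (c ∷ u) = ∈-cartesianProductWith⁺ _∷_ (∈-letters c) (∈-wordsOfLength u)

  ∈-wordsOfLength⇒length : ∀ n {u} → u ∈ wordsOfLength n → length u ≡ n
  ∈-wordsOfLength⇒length zero    (here refl) = refl
  ∈-wordsOfLength⇒length (suc n) u∈ with ∈-cartesianProductWith⁻ _∷_ letters (wordsOfLength n) u∈
  ... | _ , _ , _ , u∈′ , refl = cong suc (∈-wordsOfLength⇒length n u∈′)

  wordsOfLength-unique : Unique letters → ∀ n → Unique (wordsOfLength n)
  wordsOfLength-unique !letters zero    = All.[] ∷ []
  wordsOfLength-unique !letters (suc n) =
    Unique.cartesianProductWith⁺ _∷_ List.∷-injective !letters (wordsOfLength-unique !letters n)

  wordsShorterThan : ℕ → List (List C)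
  wordsShorterThan zero    = []
  wordsShorterThan (suc n) = wordsOfLength n ++ˡ wordsShorterThan n

  ∈-wordsShorterThan : ∀ u n → length u < n → u ∈ wordsShorterThan n
  ∈-wordsShorterThan u (suc n) |u|<1+n with length u ≟ n
  ... | yes refl = ∈-++⁺ˡ (∈-wordsOfLength u)
  ... | no |u|≢n = ∈-++⁺ʳ (wordsOfLength n) (∈-wordsShorterThan u n (≤∧≢⇒< (≤-pred |u|<1+n) |u|≢n))

module Pumping {C : Set} {N : ℕ} (δ : Fin N → C → Fin N) (s : Fin N) where

  run : Fin N → List C → Fin N
  run = foldl δ

  record Loop (u : List C) : Set where
    field
      prefix cycle suffix : List C
      split      : u ≡ prefix ++ˡ cycle ++ˡ suffix
      nonempty   : 1 ≤ length cycle
      short      : length cycle ≤ N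
      returns    : run (run s prefix) cycle ≡ run s prefix

  loop : (u : List C) → N ≤ length u → Loop u
  loop u N≤|u| with Fin.pigeonhole ≤-refl (λ (t : Fin (suc N)) → run s (take (toℕ t) u))
  ... | i , j , i<j , same-state = record
    { prefix = take a u ; cycle = drop a (take b u) ; suffix = drop b u
    ; split = split ; nonempty = subst (1 ≤_) (sym |cycle|) (m<n⇒0<n∸m i<j)
    ; short = subst (_≤ N) (sym |cycle|) (≤-trans (m∸n≤m b a) b≤N) ; returns = returns }
    where
    open ≡-Reasoning
    a = toℕ i
    b = toℕ j
    b≤N = Fin.toℕ≤pred[n] j
    take-a-b : take a u ++ˡ drop a (take b u) ≡ take b u
    take-a-b = begin
      take a u ++ˡ drop a (take b u)
        ≡⟨ cong (λ k → take k u ++ˡ drop a (take b u)) (m≤n⇒m⊓n≡m (<⇒≤ i<j)) ⟨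
      take (a ⊓ b) u ++ˡ drop a (take b u)
        ≡⟨ cong (_++ˡ drop a (take b u)) (List.take-take a b u) ⟨
      take a (take b u) ++ˡ drop a (take b u)
        ≡⟨ List.take++drop≡id a (take b u) ⟩
      take b u
        ∎
    split : u ≡ take a u ++ˡ drop a (take b u) ++ˡ drop b u
    split = begin
      u                                                  ≡⟨ List.take++drop≡id b u ⟨
      take b u ++ˡ drop b u                              ≡⟨ cong (_++ˡ drop b u) take-a-b ⟨
      (take a u ++ˡ drop a (take b u)) ++ˡ drop b u      ≡⟨ List.++-assoc (take a u) _ _ ⟩
      take a u ++ˡ drop a (take b u) ++ˡ drop b u        ∎
    |cycle| : length (drop a (take b u)) ≡ b ∸ a
    |cycle| = trans (List.length-drop a (take b u))
                    (cong (_∸ a) (trans (List.length-take b u) (m≤n⇒m⊓n≡m (≤-trans b≤N N≤|u|))))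
    returns : run (run s (take a u)) (drop a (take b u)) ≡ run s (take a u)
    returns = begin
      run (run s (take a u)) (drop a (take b u)) ≡⟨ List.foldl-++ δ s (take a u) _ ⟨
      run s (take a u ++ˡ drop a (take b u))     ≡⟨ cong (run s) take-a-b ⟩
      run s (take b u)                           ≡⟨ same-state ⟨
      run s (take a u)                           ∎

  _^_ : List C → ℕ → List C
  y ^ zero  = []
  y ^ suc k = y ++ˡ y ^ k

  run-^ : ∀ q y k → run q y ≡ q → run q (y ^ k) ≡ q
  run-^ q y zero    _        = refl
  run-^ q y (suc k) y-loops = begin
    run q (y ++ˡ y ^ k)      ≡⟨ List.foldl-++ δ q y (y ^ k) ⟩
    run (run q y) (y ^ k)    ≡⟨ cong (λ q′ → run q′ (y ^ k)) y-loops ⟩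
    run q (y ^ k)            ≡⟨ run-^ q y k y-loops ⟩
    q                        ∎
    where open ≡-Reasoning

  length-^ : ∀ y k → 1 ≤ length y → k ≤ length (y ^ k)
  length-^ y zero    _        = z≤n
  length-^ y (suc k) 1≤|y| = subst (suc k ≤_) (sym (List.length-++ y))
    (+-mono-≤ 1≤|y| (length-^ y k 1≤|y|))

  module _ {u : List C} (ℓ : Loop u) where
    open Loop ℓ

    run-pumped : ∀ k → run s (prefix ++ˡ cycle ^ k ++ˡ suffix) ≡ run s u
    run-pumped k = begin
      run s (prefix ++ˡ cycle ^ k ++ˡ suffix)     ≡⟨ run-++ prefix (cycle ^ k) ⟩
      run (run (run s prefix) (cycle ^ k)) suffix ≡⟨ cong (λ q → run q suffix) (run-^ _ cycle k returns) ⟩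
      run (run s prefix) suffix                   ≡⟨ cong (λ q → run q suffix) returns ⟨
      run (run (run s prefix) cycle) suffix       ≡⟨ run-++ prefix cycle ⟨
      run s (prefix ++ˡ cycle ++ˡ suffix)         ≡⟨ cong (run s) split ⟨
      run s u                                     ∎
      where
      open ≡-Reasoning
      run-++ : ∀ x y → run s (x ++ˡ y ++ˡ suffix) ≡ run (run (run s x) y) suffix
      run-++ x y = trans (List.foldl-++ δ s x (y ++ˡ suffix)) (List.foldl-++ δ (run s x) y suffix)

    length-pumped : ∀ k → length (prefix ++ˡ cycle ^ k ++ˡ suffix)
                        ≡ length prefix + (length (cycle ^ k) + length suffix)
    length-pumped k = trans (List.length-++ prefix) (cong (length prefix +_) (List.length-++ (cycle ^ k)))

    length-cut : length u ≡ length cycle + length (prefix ++ˡ suffix)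
    length-cut = begin
      length u                                        ≡⟨ cong length split ⟩
      length (prefix ++ˡ cycle ++ˡ suffix)            ≡⟨ List.length-++ prefix ⟩
      length prefix + length (cycle ++ˡ suffix)       ≡⟨ cong (length prefix +_) (List.length-++ cycle) ⟩
      length prefix + (length cycle + length suffix)  ≡⟨ +-exchange (length prefix) (length cycle) _ ⟩
      length cycle + (length prefix + length suffix)  ≡⟨ cong (length cycle +_) (List.length-++ prefix) ⟨
      length cycle + length (prefix ++ˡ suffix)       ∎
      where open ≡-Reasoning

  module _ (p : Fin N) where

    Reaches : List C → Set
    Reaches u = run s u ≡ p

    long-reaching⇒infinite : (u : List C) → N ≤ length u → Reaches u → HasCard Reaches ∞
    long-reaching⇒infinite u N≤|u| reaches (n , ws , _ , _ , Reaches⇔ws) =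
      <⇒≱ ≤-refl (≤-trans k≤|w| (≤-maxLength (to (Reaches⇔ws w) (trans (run-pumped ℓ k) reaches))))
      where
      ℓ = loop u N≤|u|
      open Loop ℓ
      k = suc (maxLength ws)
      w = prefix ++ˡ cycle ^ k ++ˡ suffix
      k≤|w| : k ≤ length w
      k≤|w| = subst (k ≤_) (sym (length-pumped ℓ k))
        (≤-trans (length-^ cycle k nonempty) (≤-trans (m≤m+n _ (length suffix)) (m≤n+m _ (length prefix))))

module ReachingWords {C : Set} (_≟_ : DecidableEquality C) (letters : List C) (∈-letters : ∀ c → c ∈ letters)
                     {N : ℕ} (δ : Fin N → C → Fin N) (s : Fin N) where
  open Words letters ∈-letters
  open Pumping δ s public

  module _ (p : Fin N) where

    -- Reaches p is infinite iff it contains a word of length in [N, 2N): a longer word can be shortened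
    -- by cutting out a cycle of length ≤ N.
    Window : Set
    Window = Any (λ u → N ≤ length u × Reaches p u) (wordsShorterThan (N + N))

    window? : Dec Window
    window? = any? (λ u → (N ≤? length u) ×-dec (run s u Fin.≟ p)) (wordsShorterThan (N + N))

    no-window⇒short : ¬ Window → ∀ u → Reaches p u → length u < N
    no-window⇒short ¬window u = <-rec (λ n → ∀ u → length u ≡ n → Reaches p u → length u < N) step _ u refl
      where
      step : ∀ n → (∀ {m} → m < n → ∀ v → length v ≡ m → Reaches p v → length v < N)
           → ∀ u → length u ≡ n → Reaches p u → length u < N
      step n shorter u refl reaches with N ≤? length u
      ... | no  N≰|u| = ≰⇒> N≰|u|
      ... | yes N≤|u| with length u <? N + N
      ...   | yes |u|<2N =
        ⊥-elim (¬window (Any.map (λ { refl → N≤|u| , reaches }) (∈-wordsShorterThan u (N + N) |u|<2N)))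
      ...   | no  |u|≮2N = ⊥-elim (<⇒≱ (shorter |v|<|u| v refl (trans (run-pumped ℓ 0) reaches)) N≤|v|)
        where
        ℓ = loop u N≤|u|
        open Loop ℓ
        v = prefix ++ˡ suffix
        |v|<|u| : length v < length u
        |v|<|u| = subst (length v <_) (sym (length-cut ℓ)) (m<n+m (length v) nonempty)
        N≤|v| : N ≤ length v
        N≤|v| = +-cancelˡ-≤ N N (length v)
          (≤-trans (≮⇒≥ |u|≮2N) (subst (_≤ N + length v) (sym (length-cut ℓ)) (+-monoˡ-≤ (length v) short)))

    reachingCard : Σ ℕ∞ (HasCard (Reaches p))
    reachingCard with window?
    ... | yes window = let u , (N≤|u| , reaches) = satisfied window in ∞ , long-reaching⇒infinite p u N≤|u| reaches
    ... | no ¬window =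
      let n , card = covered⇒finite (List.≡-dec _≟_) (λ u → run s u Fin.≟ p) (wordsShorterThan N)
                       (λ u reaches → ∈-wordsShorterThan u N (no-window⇒short ¬window u reaches))
      in fin n , card

-- Radix order and representations

module _ {k : ℕ} where

  <rad-trans : {u v w : List (Fin k)} → u <rad v → v <rad w → u <rad w
  <rad-trans (inj₁ |u|<|v|)        (inj₁ |v|<|w|)        = inj₁ (<-trans |u|<|v| |v|<|w|)
  <rad-trans (inj₁ |u|<|v|)        (inj₂ (|v|≡|w| , _))  = inj₁ (subst (_ <_) |v|≡|w| |u|<|v|)
  <rad-trans (inj₂ (|u|≡|v| , _))  (inj₁ |v|<|w|)        = inj₁ (subst (_< _) (sym |u|≡|v|) |v|<|w|)
  <rad-trans (inj₂ (|u|≡|v| , u<v)) (inj₂ (|v|≡|w| , v<w)) =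
    inj₂ (trans |u|≡|v| |v|≡|w| , <-transitive isEquivalence Fin.<-resp₂-≡ Fin.<-trans u<v v<w)

  <rad-irrefl : {u : List (Fin k)} → ¬ (u <rad u)
  <rad-irrefl (inj₁ |u|<|u|)    = <-irrefl refl |u|<|u|
  <rad-irrefl (inj₂ (_ , u<u)) = <-irreflexive Fin.<-irrefl (≡⇒Pointwise-≡ refl) u<u

  <rad-total : (u v : List (Fin k)) → u ≡ v ⊎ u <rad v ⊎ v <rad u
  <rad-total u v with <-cmp (length u) (length v)
  ... | tri< |u|<|v| _ _ = inj₂ (inj₁ (inj₁ |u|<|v|))
  ... | tri> _ _ |v|<|u| = inj₂ (inj₂ (inj₁ |v|<|u|))
  ... | tri≈ _ |u|≡|v| _ with <-compare sym Fin.<-cmp u v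
  ...   | tri< u<v _ _ = inj₂ (inj₁ (inj₂ (|u|≡|v| , u<v)))
  ...   | tri≈ _ u≋v _ = inj₁ (Pointwise-≡⇒≡ u≋v)
  ...   | tri> _ _ v<u = inj₂ (inj₂ (inj₂ (sym |u|≡|v| , v<u)))

  <rad? : (u v : List (Fin k)) → Dec (u <rad v)
  <rad? u v = (length u <? length v) ⊎-dec ((length u ≟ length v) ×-dec <-decidable Fin._≟_ Fin._<?_ u v)

  <rad⇒length-≤ : {u v : List (Fin k)} → u <rad v → length u ≤ length v
  <rad⇒length-≤ (inj₁ |u|<|v|)     = <⇒≤ |u|<|v|
  <rad⇒length-≤ (inj₂ (|u|≡|v| , _)) = ≤-reflexive |u|≡|v|

  maximum-<rad : (x : List (Fin k)) (xs : List (List (Fin k)))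
    → Σ (List (Fin k)) λ m → m ∈ x ∷ xs × (∀ y → y ∈ x ∷ xs → y ≡ m ⊎ y <rad m)
  maximum-<rad x [] = x , here refl , λ { y (here y≡x) → inj₁ y≡x }
  maximum-<rad x (x′ ∷ xs) with maximum-<rad x′ xs
  ... | m , m∈ , ≤m with <rad-total x m
  ...   | inj₁ refl        = m , here refl , λ { y (here y≡x) → inj₁ y≡x ; y (there y∈) → ≤m y y∈ }
  ...   | inj₂ (inj₁ x<m) = m , there m∈ , λ { y (here refl) → inj₂ x<m ; y (there y∈) → ≤m y y∈ }
  ...   | inj₂ (inj₂ m<x) =
    x , here refl , λ { y (here y≡x) → inj₁ y≡x ; y (there y∈) → inj₂ (<x (≤m y y∈)) }
    where
    <x : ∀ {y} → y ≡ m ⊎ y <rad m → y <rad x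
    <x (inj₁ refl) = m<x
    <x (inj₂ y<m)  = <rad-trans y<m m<x

module Representation (T : ANS) where
  open ANS T
  open DFA dfa
  open Words (allFin size) ∈-allFin

  Lang? : (v : Word T) → Dec (Lang T v)
  Lang? v = T? (final (foldl δ start v))

  Below : Word T → Word T → Set
  Below u v = Lang T v × v <rad u

  Below? : (u v : Word T) → Dec (Below u v)
  Below? u v = Lang? v ×-dec <rad? v u

  Below-finite : (u : Word T) → Σ ℕ (FinCard (Below u))
  Below-finite u = covered⇒finite (List.≡-dec Fin._≟_) (Below? u) (wordsShorterThan (suc (length u)))
    (λ v (_ , v<u) → ∈-wordsShorterThan v (suc (length u)) (s≤s (<rad⇒length-≤ v<u)))

  Below-card-< : {u w : Word T} → Lang T u → u <rad w
               → ∀ {m n} → FinCard (Below u) m → FinCard (Below w) n → m < n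
  Below-card-< {u} Lu u<w card-u card-w =
    FinCard-⊂⇒< card-u card-w (λ v (Lv , v<u) → Lv , <rad-trans v<u u<w)
                u (Lu , u<w) (λ (_ , u<u) → <rad-irrefl u<u)

  Rep-injective : {n n′ : ℕ} {u : Word T} → Rep T n u → Rep T n′ u → n ≡ n′
  Rep-injective (_ , card) (_ , card′) = FinCard-unique card card′

  Rep-functional : {n : ℕ} {u u′ : Word T} → Rep T n u → Rep T n u′ → u ≡ u′
  Rep-functional {u = u} {u′} (Lu , card) (Lu′ , card′) with <rad-total u u′
  ... | inj₁ u≡u′        = u≡u′
  ... | inj₂ (inj₁ u<u′) = ⊥-elim (<-irrefl refl (Below-card-< Lu u<u′ card card′))
  ... | inj₂ (inj₂ u′<u) = ⊥-elim (<-irrefl refl (Below-card-< Lu′ u′<u card′ card))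

  -- The radix-largest word below w has one word fewer below it; descend until n is reached.
  rep-below : (c : ℕ) (w : Word T) → Lang T w → FinCard (Below w) c
            → (n : ℕ) → n ≤ c → Σ (Word T) (Rep T n)
  rep-below c w Lw card n n≤c with n ≟ c
  ... | yes refl = w , Lw , card
  rep-below zero    w Lw card n n≤c | no n≢c = ⊥-elim (n≢c (n≤0⇒n≡0 n≤c))
  rep-below (suc c) w Lw (x ∷ xs , |xs| , !xs , Below⇔xs) n n≤c | no n≢c with maximum-<rad x xs
  ... | v , v∈ , ≤v = rep-below c v (proj₁ below-w) card-v n (≤-pred (≤∧≢⇒< n≤c n≢c))
    where
    below-w : Below w v
    below-w = from (Below⇔xs v) v∈
    m = proj₁ (Below-finite v)
    Below-w⇔ : ∀ y → (Below v y ⊎ y ≡ v) ⇔ Below w y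
    Below-w⇔ y = mk⇔
      (Sum.[ (λ (Ly , y<v) → Ly , <rad-trans y<v (proj₂ below-w)) , (λ { refl → below-w }) ])
      (λ below → Sum.map (λ y<v → proj₁ below , y<v) (λ y≡v → y≡v) (Sum.swap (≤v y (to (Below⇔xs y) below))))
    card-w : HasCard (Below w) (fin (m + 1))
    card-w = HasCard-resp-⇔ Below-w⇔
      (HasCard-⊎ (List.≡-dec Fin._≟_) (Below? v) (λ y → List.≡-dec Fin._≟_ y v)
        (λ { y (_ , y<v) refl → <rad-irrefl y<v }) (proj₂ (Below-finite v)) (FinCard-≡ v))
    card-v : FinCard (Below v) c
    card-v = subst (FinCard (Below v))
      (suc-injective (trans (+-comm 1 m) (FinCard-unique card-w (x ∷ xs , |xs| , !xs , Below⇔xs))))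
      (proj₂ (Below-finite v))

  word-with-many-below : (n : ℕ) → Σ (Word T) λ w → Lang T w × Σ ℕ λ c → FinCard (Below w) c × n ≤ c
  word-with-many-below zero =
    let w , Lw , _ = infinite 0 in w , Lw , proj₁ (Below-finite w) , proj₂ (Below-finite w) , z≤n
  word-with-many-below (suc n) =
    let w , Lw , c , card , n≤c = word-with-many-below n
        w′ , Lw′ , |w|<|w′| = infinite (suc (length w))
        c′ , card′ = Below-finite w′
    in w′ , Lw′ , c′ , card′ , ≤-trans (s≤s n≤c) (Below-card-< Lw (inj₁ |w|<|w′|) card card′)

  rep-exists : (n : ℕ) → Σ (Word T) (Rep T n)
  rep-exists n = let w , Lw , c , card , n≤c = word-with-many-below n in rep-below c w Lw card n n≤c

-- Multidimensional words, column by column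

Column : Vec ANS e → Set
Column {e} Ts = (j : Fin e) → Maybe (Fin (ANS.size (lookup Ts j)))

-- Columns as nested tuples, which, unlike functions, have decidable equality and can be enumerated.
Tuple : Vec ANS e → Set
Tuple []       = ⊤
Tuple (T ∷ Ts) = Maybe (Fin (ANS.size T)) × Tuple Ts

lookupᵗ : {Ts : Vec ANS e} → Tuple Ts → Column Ts
lookupᵗ {Ts = T ∷ Ts} (x , xs) fzero    = x
lookupᵗ {Ts = T ∷ Ts} (x , xs) (fsuc j) = lookupᵗ xs j

tabulateᵗ : {Ts : Vec ANS e} → Column Ts → Tuple Ts
tabulateᵗ {Ts = []}     c = tt
tabulateᵗ {Ts = T ∷ Ts} c = c fzero , tabulateᵗ (λ j → c (fsuc j))

lookupᵗ-tabulateᵗ : {Ts : Vec ANS e} (c : Column Ts) (j : Fin e) → lookupᵗ (tabulateᵗ {Ts = Ts} c) j ≡ c j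
lookupᵗ-tabulateᵗ {Ts = T ∷ Ts} c fzero    = refl
lookupᵗ-tabulateᵗ {Ts = T ∷ Ts} c (fsuc j) = lookupᵗ-tabulateᵗ {Ts = Ts} (λ j → c (fsuc j)) j

lookupᵗ-injective : {Ts : Vec ANS e} (t t′ : Tuple Ts) → (∀ j → lookupᵗ t j ≡ lookupᵗ t′ j) → t ≡ t′
lookupᵗ-injective {Ts = []}     tt       tt         _   = refl
lookupᵗ-injective {Ts = T ∷ Ts} (x , t) (x′ , t′) t≗t′ =
  cong₂ _,_ (t≗t′ fzero) (lookupᵗ-injective t t′ (λ j → t≗t′ (fsuc j)))

_≟ᵗ_ : {Ts : Vec ANS e} → DecidableEquality (Tuple Ts)
_≟ᵗ_ {Ts = []}     tt tt = yes refl
_≟ᵗ_ {Ts = T ∷ Ts} = Product.≡-dec (Maybe.≡-dec Fin._≟_) _≟ᵗ_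

allMaybe : (k : ℕ) → List (Maybe (Fin k))
allMaybe k = nothing ∷ map just (allFin k)

∈-allMaybe : {k : ℕ} (x : Maybe (Fin k)) → x ∈ allMaybe k
∈-allMaybe nothing  = here refl
∈-allMaybe (just x) = there (∈-map⁺ just (∈-allFin x))

allMaybe-unique : (k : ℕ) → Unique (allMaybe k)
allMaybe-unique k = All.tabulate nothing∉ ∷ Unique.map⁺ Maybe.just-injective (Unique.allFin⁺ k)
  where
  nothing∉ : ∀ {y} → y ∈ map just (allFin k) → nothing ≢ y
  nothing∉ y∈ refl with ∈-map⁻ just y∈
  ... | _ , _ , ()

allTuples : (Ts : Vec ANS e) → List (Tuple Ts)
allTuples []       = [ tt ]
allTuples (T ∷ Ts) = cartesianProductWith _,_ (allMaybe (ANS.size T)) (allTuples Ts)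

∈-allTuples : {Ts : Vec ANS e} (t : Tuple Ts) → t ∈ allTuples Ts
∈-allTuples {Ts = []}     tt      = here refl
∈-allTuples {Ts = T ∷ Ts} (x , t) = ∈-cartesianProductWith⁺ _,_ (∈-allMaybe x) (∈-allTuples t)

allTuples-unique : (Ts : Vec ANS e) → Unique (allTuples Ts)
allTuples-unique []       = All.[] ∷ []
allTuples-unique (T ∷ Ts) =
  Unique.cartesianProductWith⁺ _,_ Product.,-injective (allMaybe-unique _) (allTuples-unique Ts)

appendᶜ : (S : Vec ANS d) (S′ : Vec ANS d′) → Column S → Column S′ → Column (S ++ S′)
appendᶜ []      S′ a b k        = b k
appendᶜ (_ ∷ S) S′ a b fzero    = a fzero
appendᶜ (_ ∷ S) S′ a b (fsuc k) = appendᶜ S S′ (λ i → a (fsuc i)) b k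

anyJust-appendᶜ : (S : Vec ANS d) (S′ : Vec ANS d′) (a : Column S) (b : Column S′)
                → anyJust (appendᶜ S S′ a b) ≡ anyJust a ∨ anyJust b
anyJust-appendᶜ []      S′ a b = refl
anyJust-appendᶜ (_ ∷ S) S′ a b =
  trans (cong (is-just (a fzero) ∨_) (anyJust-appendᶜ S S′ (λ i → a (fsuc i)) b))
        (sym (∨-assoc (is-just (a fzero)) _ _))

anyJust⇒just : {B : Fin e → Set} (v : (j : Fin e) → Maybe (B j)) → T (anyJust v)
             → Σ (Fin e) λ j → Σ (B j) λ x → v j ≡ just x
anyJust⇒just {suc e} v any with v fzero in eq
... | just x  = fzero , x , eq
... | nothing = let j , x , eq′ = anyJust⇒just (λ j → v (fsuc j)) any in fsuc j , x , eq′

just⇒anyJust : {B : Fin e → Set} (v : (j : Fin e) → Maybe (B j)) (j : Fin e) {x : B j}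
             → v j ≡ just x → T (anyJust v)
just⇒anyJust v fzero vj≡just rewrite vj≡just = tt
just⇒anyJust {suc e} v (fsuc j) vj≡just with is-just (v fzero)
... | true  = tt
... | false = just⇒anyJust (λ j → v (fsuc j)) j vj≡just

module _ {X : Set} (Φ : (A : ANS) → List (Maybe (Fin (ANS.size A))) → ℕ → Set)
         (xs : List X) where

  columns-appendᶜ⁺ : (S : Vec ANS d) (S′ : Vec ANS d′) (a : X → Column S) (b : X → Column S′)
    (ns : Vec ℕ d) (ns′ : Vec ℕ d′)
    → (∀ i → Φ (lookup S i) (map (λ x → a x i) xs) (lookup ns i))
    → (∀ j → Φ (lookup S′ j) (map (λ x → b x j) xs) (lookup ns′ j))
    → ∀ k → Φ (lookup (S ++ S′) k) (map (λ x → appendᶜ S S′ (a x) (b x) k) xs) (lookup (ns ++ ns′) k)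
  columns-appendᶜ⁺ []      S′ a b []       ns′ Φa Φb k        = Φb k
  columns-appendᶜ⁺ (_ ∷ S) S′ a b (_ ∷ ns) ns′ Φa Φb fzero    = Φa fzero
  columns-appendᶜ⁺ (_ ∷ S) S′ a b (_ ∷ ns) ns′ Φa Φb (fsuc k) =
    columns-appendᶜ⁺ S S′ (λ x i → a x (fsuc i)) b ns ns′ (λ i → Φa (fsuc i)) Φb k

  columns-appendᶜ⁻ : (S : Vec ANS d) (S′ : Vec ANS d′) (a : X → Column S) (b : X → Column S′)
    (ms : Vec ℕ (d + d′))
    → (∀ k → Φ (lookup (S ++ S′) k) (map (λ x → appendᶜ S S′ (a x) (b x) k) xs) (lookup ms k))
    → (∀ i → Φ (lookup S i) (map (λ x → a x i) xs) (lookup (Vec.take d ms) i))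
    × (∀ j → Φ (lookup S′ j) (map (λ x → b x j) xs) (lookup (Vec.drop d ms) j))
  columns-appendᶜ⁻ []      S′ a b ms       Φab = (λ ()) , Φab
  columns-appendᶜ⁻ (_ ∷ S) S′ a b (_ ∷ ms) Φab =
    let Φa , Φb = columns-appendᶜ⁻ S S′ (λ x i → a x (fsuc i)) b ms (λ k → Φab (fsuc k))
    in (λ { fzero → Φab fzero ; (fsuc i) → Φa i }) , Φb

padLeft : ℕ → List B → List (Maybe B)
padLeft L u = replicate (L ∸ length u) nothing ++ˡ map just u

-- RepT Ts ns w unfolds to ∀ j → PaddedRep (length w) (lookup Ts j) (proj Ts j w) (lookup ns j).
PaddedRep : ℕ → (A : ANS) → List (Maybe (Fin (ANS.size A))) → ℕ → Set
PaddedRep L A p n = Σ (Word A) λ u → p ≡ padLeft L u × Rep A n u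

blanks++just-injective : (a b : ℕ) (u u′ : List B)
  → replicate a nothing ++ˡ map just u ≡ replicate b nothing ++ˡ map just u′ → u ≡ u′
blanks++just-injective zero    zero    u       u′       eq = List.map-injective Maybe.just-injective eq
blanks++just-injective (suc a) (suc b) u       u′       eq = blanks++just-injective a b u u′ (List.∷-injectiveʳ eq)
blanks++just-injective zero    (suc b) (_ ∷ _) u′       ()
blanks++just-injective (suc a) zero    u       (_ ∷ _)  ()

blanks++-cancel : (k a : ℕ) (q : List (Maybe B)) (u : List B)
  → replicate k nothing ++ˡ q ≡ replicate a nothing ++ˡ map just u
  → q ≡ replicate (a ∸ k) nothing ++ˡ map just u
blanks++-cancel zero    a       q u       eq = eq
blanks++-cancel (suc k) (suc a) q u       eq = blanks++-cancel k a q u (List.∷-injectiveʳ eq)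
blanks++-cancel (suc k) zero    q (_ ∷ _) ()

just∷≡padLeft⇒no-blanks : (a : ℕ) (u : List B) {x : B} {q : List (Maybe B)}
  → just x ∷ q ≡ replicate a nothing ++ˡ map just u → a ≡ 0
just∷≡padLeft⇒no-blanks zero    u eq = refl
just∷≡padLeft⇒no-blanks (suc a) u ()

length-blanks++just : (a : ℕ) (u : List B) → length (replicate a nothing ++ˡ map just u) ≡ a + length u
length-blanks++just a u =
  trans (List.length-++ (replicate a nothing)) (cong₂ _+_ (List.length-replicate a) (List.length-map just u))

length-≡padLeft⇒≤ : {L : ℕ} {q : List (Maybe B)} (u : List B)
                  → q ≡ padLeft L u → length q ≡ L → length u ≤ L
length-≡padLeft⇒≤ {L = L} u q≡ |q|≡L with length u ≤? L
... | yes |u|≤L = |u|≤L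
... | no  |u|≰L = subst (length u ≤_)
  (trans (cong (_+ length u) (sym (m≤n⇒m∸n≡0 (<⇒≤ (≰⇒> |u|≰L)))))
         (trans (sym (length-blanks++just (L ∸ length u) u)) (trans (cong length (sym q≡)) |q|≡L))) ≤-refl

PaddedRep-injective : {L : ℕ} {A : ANS} {p : List (Maybe (Fin (ANS.size A)))} {n n′ : ℕ}
                    → PaddedRep L A p n → PaddedRep L A p n′ → n ≡ n′
PaddedRep-injective {L} {A} (u , p≡ , rep) (u′ , p≡′ , rep′)
  with blanks++just-injective (L ∸ length u) (L ∸ length u′) u u′ (trans (sym p≡) p≡′)
... | refl = Representation.Rep-injective A rep rep′

PaddedRep-unpad : (k m : ℕ) {A : ANS} (q : List (Maybe (Fin (ANS.size A)))) {n : ℕ} → length q ≡ m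
                → PaddedRep (k + m) A (replicate k nothing ++ˡ q) n → PaddedRep m A q n
PaddedRep-unpad k m q |q|≡m (u , q≡ , rep) =
  u , trans q≡′ (cong (λ a → replicate a nothing ++ˡ map just u) blanks≡) , rep
  where
  q≡′ = blanks++-cancel k _ q u q≡
  a = (k + m ∸ length u) ∸ k
  blanks≡ : a ≡ m ∸ length u
  blanks≡ = trans (sym (m+n∸n≡m a (length u)))
    (cong (_∸ length u) (trans (sym (length-blanks++just a u)) (trans (cong length (sym q≡′)) |q|≡m)))

PaddedRep-pad : (k m : ℕ) {A : ANS} (q : List (Maybe (Fin (ANS.size A)))) {n : ℕ} → length q ≡ m
              → PaddedRep m A q n → PaddedRep (k + m) A (replicate k nothing ++ˡ q) n
PaddedRep-pad k m q |q|≡m (u , q≡ , rep) = u , padded , rep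
  where
  open ≡-Reasoning
  padded : replicate k nothing ++ˡ q ≡ padLeft (k + m) u
  padded = begin
    replicate k nothing ++ˡ q
      ≡⟨ cong (replicate k nothing ++ˡ_) q≡ ⟩
    replicate k nothing ++ˡ (replicate (m ∸ length u) nothing ++ˡ map just u)
      ≡⟨ List.++-assoc (replicate k nothing) _ _ ⟨
    (replicate k nothing ++ˡ replicate (m ∸ length u) nothing) ++ˡ map just u
      ≡⟨ cong (_++ˡ map just u) (replicate-++ k (m ∸ length u)) ⟩
    replicate (k + (m ∸ length u)) nothing ++ˡ map just u
      ≡⟨ cong (λ a → replicate a nothing ++ˡ map just u) (+-∸-assoc k (length-≡padLeft⇒≤ u q≡ |q|≡m)) ⟨
    padLeft (k + m) u
      ∎

ColumnWords : Vec ANS e → Set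
ColumnWords {e} Ts = (j : Fin e) → List (Maybe (Fin (ANS.size (lookup Ts j))))

headᵐ : List (Maybe B) → Maybe B
headᵐ []      = nothing
headᵐ (x ∷ _) = x

transpose : {Ts : Vec ANS e} (L : ℕ) → ColumnWords Ts → List (Tuple Ts)
transpose zero    p = []
transpose (suc L) p = tabulateᵗ (λ j → headᵐ (p j)) ∷ transpose L (λ j → drop 1 (p j))

length-transpose : {Ts : Vec ANS e} (L : ℕ) (p : ColumnWords Ts) → length (transpose {Ts = Ts} L p) ≡ L
length-transpose zero    p = refl
length-transpose (suc L) p = cong suc (length-transpose L _)

column-transpose : {Ts : Vec ANS e} (L : ℕ) (p : ColumnWords Ts) → (∀ j → length (p j) ≡ L)
                 → ∀ j → map (λ t → lookupᵗ t j) (transpose {Ts = Ts} L p) ≡ p j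
column-transpose zero p |p|≡L j with p j | |p|≡L j
... | [] | _ = refl
column-transpose {Ts = Ts} (suc L) p |p|≡L j with p j in pj≡ | |p|≡L j
... | x ∷ xs | _ = cong₂ _∷_ (trans (lookupᵗ-tabulateᵗ {Ts = Ts} (λ j → headᵐ (p j)) j) (cong headᵐ pj≡))
  (trans (column-transpose L _ |tail|≡L j) (cong (drop 1) pj≡))
  where
  |tail|≡L : ∀ j′ → length (drop 1 (p j′)) ≡ L
  |tail|≡L j′ with p j′ | |p|≡L j′
  ... | _ ∷ _ | refl = refl

maxᶠ : (Fin e → ℕ) → ℕ
maxᶠ {zero}  f = 0
maxᶠ {suc e} f = f fzero ⊔ maxᶠ (λ j → f (fsuc j))

≤-maxᶠ : (f : Fin e → ℕ) (j : Fin e) → f j ≤ maxᶠ f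
≤-maxᶠ f fzero    = m≤m⊔n _ _
≤-maxᶠ f (fsuc j) = ≤-trans (≤-maxᶠ (λ j → f (fsuc j)) j) (m≤n⊔m (f fzero) _)

maxᶠ-attained : (f : Fin e → ℕ) → maxᶠ f ≡ 0 ⊎ Σ (Fin e) λ j → maxᶠ f ≡ f j
maxᶠ-attained {zero}  f = inj₁ refl
maxᶠ-attained {suc e} f with ⊔-sel (f fzero) (maxᶠ (λ j → f (fsuc j)))
... | inj₁ max≡f₀ = inj₂ (fzero , max≡f₀)
... | inj₂ max≡rest with maxᶠ-attained (λ j → f (fsuc j))
...   | inj₁ rest≡0       = inj₁ (trans max≡rest rest≡0)
...   | inj₂ (j , rest≡fj) = inj₂ (fsuc j , trans max≡rest rest≡fj)

columnᵗ : {Ts : Vec ANS e} (j : Fin e) → List (Tuple Ts) → List (Maybe (Fin (ANS.size (lookup Ts j))))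
columnᵗ j = map (λ t → lookupᵗ t j)

columnᵗ-injective : {Ts : Vec ANS e} (ts ts′ : List (Tuple Ts)) → length ts ≡ length ts′
                  → (∀ j → columnᵗ j ts ≡ columnᵗ j ts′) → ts ≡ ts′
columnᵗ-injective []       []         _          _ = refl
columnᵗ-injective (t ∷ ts) (t′ ∷ ts′) |ts|≡|ts′| cols≡ =
  cong₂ _∷_ (lookupᵗ-injective t t′ (λ j → List.∷-injectiveˡ (cols≡ j)))
            (columnᵗ-injective ts ts′ (suc-injective |ts|≡|ts′|) (λ j → List.∷-injectiveʳ (cols≡ j)))

nonBlank-head⇒≤ : {Ts : Vec ANS e} {L₁ L₂ : ℕ} (ts : List (Tuple Ts)) (t : Tuple Ts) (rest : List (Tuple Ts))
  → length ts ≡ L₁ → T (anyJust (lookupᵗ t)) → (ns : Vec ℕ e)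
  → (∀ j → PaddedRep L₁ (lookup Ts j) (columnᵗ j ts) (lookup ns j))
  → (∀ j → PaddedRep L₂ (lookup Ts j) (columnᵗ j (t ∷ rest)) (lookup ns j))
  → L₂ ≤ L₁
nonBlank-head⇒≤ {Ts = Ts} {L₁} {L₂} ts t rest |ts|≡L₁ nonblank ns reps₁ reps₂
  with anyJust⇒just (lookupᵗ t) nonblank
... | j , x , tj≡just with reps₁ j | reps₂ j
... | w₁ , col₁≡ , rep₁ | w₂ , col₂≡ , rep₂ = begin
  L₂         ≤⟨ m∸n≡0⇒m≤n (just∷≡padLeft⇒no-blanks (L₂ ∸ length w₂) w₂
                  (trans (cong (_∷ columnᵗ j rest) (sym tj≡just)) col₂≡)) ⟩
  length w₂  ≡⟨ cong length (Representation.Rep-functional (lookup Ts j) rep₂ rep₁) ⟩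
  length w₁  ≤⟨ length-≡padLeft⇒≤ w₁ col₁≡ (trans (List.length-map _ ts) |ts|≡L₁) ⟩
  L₁         ∎
  where open ≤-Reasoning

RepT-injective : {Ts : Vec ANS e} {ms ms′ : Vec ℕ e} {w : List (Letter Ts)}
               → RepT Ts ms w → RepT Ts ms′ w → ms ≡ ms′
RepT-injective {Ts = Ts} {ms} {ms′} rep rep′ =
  lookup-injective ms ms′ (λ k → PaddedRep-injective {A = lookup Ts k} (rep k) (rep′ k))
-- Words of S ++ S′ with a given S-part

module Splitting {d d′ : ℕ} (S : Vec ANS d) (S′ : Vec ANS d′) where

  IsNonBlank : Tuple S′ → Set
  IsNonBlank t = T (anyJust (lookupᵗ t))

  NonBlank : Set
  NonBlank = Σ (Tuple S′) IsNonBlank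

  NonBlank-proj₁-injective : {x y : NonBlank} → proj₁ x ≡ proj₁ y → x ≡ y
  NonBlank-proj₁-injective {t , p} {.t , p′} refl = cong (t ,_) (T-irrelevant p p′)

  _≟ⁿᵇ_ : DecidableEquality NonBlank
  (t , _) ≟ⁿᵇ (t′ , _) with t ≟ᵗ t′
  ... | yes t≡t′ = yes (NonBlank-proj₁-injective t≡t′)
  ... | no  t≢t′ = no (λ eq → t≢t′ (cong proj₁ eq))

  nonBlanks : List (Tuple S′) → List NonBlank
  nonBlanks []       = []
  nonBlanks (t ∷ ts) with T? (anyJust (lookupᵗ t))
  ... | yes p = (t , p) ∷ nonBlanks ts
  ... | no  _ = nonBlanks ts

  ∈-nonBlanks : {t : Tuple S′} (ts : List (Tuple S′)) → t ∈ ts → (p : IsNonBlank t) → (t , p) ∈ nonBlanks ts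
  ∈-nonBlanks (t ∷ ts) (here refl) p with T? (anyJust (lookupᵗ t))
  ... | yes _  = here (NonBlank-proj₁-injective refl)
  ... | no  ¬p = ⊥-elim (¬p p)
  ∈-nonBlanks (t′ ∷ ts) (there t∈) p with T? (anyJust (lookupᵗ t′))
  ... | yes _ = there (∈-nonBlanks ts t∈ p)
  ... | no  _ = ∈-nonBlanks ts t∈ p

  allNonBlank : List NonBlank
  allNonBlank = nonBlanks (allTuples S′)

  ∈-allNonBlank : ∀ x → x ∈ allNonBlank
  ∈-allNonBlank (t , p) = ∈-nonBlanks (allTuples S′) (∈-allTuples t) p

  SplitLetter : Set
  SplitLetter = Σ (Column S × Tuple S′) λ (a , t) → T (anyJust (appendᶜ S S′ a (lookupᵗ t)))

  toLetter : SplitLetter → Letter (S ++ S′)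
  toLetter ((a , t) , p) = appendᶜ S S′ a (lookupᵗ t) , p

  sColumn : SplitLetter → Column S
  sColumn ((a , _) , _) = a

  s′Column : SplitLetter → Column S′
  s′Column ((_ , t) , _) = lookupᵗ t

  blankLetter : NonBlank → SplitLetter
  blankLetter (t , p) =
    ((λ _ → nothing) , t) ,
    subst T (sym (anyJust-appendᶜ S S′ (λ _ → nothing) (lookupᵗ t))) (from T-∨ (inj₂ p))

  pairLetter : Letter S → Tuple S′ → SplitLetter
  pairLetter (a , p) t = (a , t) , subst T (sym (anyJust-appendᶜ S S′ a (lookupᵗ t))) (from T-∨ (inj₁ p))

  -- Every word of the numeration language of S ++ S′ with S-part z has this shape, with |ts| = |z|.
  splitLetters : List (Letter S) → List NonBlank → List (Tuple S′) → List SplitLetter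
  splitLetters z u ts = map blankLetter u ++ˡ zipWith pairLetter z ts

  word : List (Letter S) → List NonBlank → List (Tuple S′) → List (Letter (S ++ S′))
  word z u ts = map toLetter (splitLetters z u ts)

  ColumnReps : List (Letter S) → Vec ℕ d′ → List NonBlank × List (Tuple S′) → Set
  ColumnReps z n′ (u , ts) =
    ∀ j → PaddedRep (length u + length z) (lookup S′ j) (columnᵗ j (map proj₁ u ++ˡ ts)) (lookup n′ j)

  module _ (z : List (Letter S)) (u : List NonBlank) (ts : List (Tuple S′)) (|ts|≡|z| : length ts ≡ length z) where

    sColumn-splitLetters : (i : Fin d)
      → map (λ x → sColumn x i) (splitLetters z u ts) ≡ replicate (length u) nothing ++ˡ proj S i z
    sColumn-splitLetters i = trans (List.map-++ _ (map blankLetter u) _)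
      (cong₂ _++ˡ_ (trans (sym (List.map-∘ u)) (map-const nothing u)) (zipped z ts |ts|≡|z|))
      where
      zipped : (z : List (Letter S)) (ts : List (Tuple S′)) → length ts ≡ length z
             → map (λ x → sColumn x i) (zipWith pairLetter z ts) ≡ proj S i z
      zipped []      []       _    = refl
      zipped (_ ∷ z) (_ ∷ ts) |≡| = cong (_ ∷_) (zipped z ts (suc-injective |≡|))

    s′Column-splitLetters : (j : Fin d′)
      → map (λ x → s′Column x j) (splitLetters z u ts) ≡ columnᵗ j (map proj₁ u ++ˡ ts)
    s′Column-splitLetters j = trans (List.map-++ _ (map blankLetter u) _)
      (trans (cong₂ _++ˡ_ (trans (sym (List.map-∘ u)) (List.map-∘ u)) (zipped z ts |ts|≡|z|))
             (sym (List.map-++ _ (map proj₁ u) ts)))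
      where
      zipped : (z : List (Letter S)) (ts : List (Tuple S′)) → length ts ≡ length z
             → map (λ x → s′Column x j) (zipWith pairLetter z ts) ≡ columnᵗ j ts
      zipped []      []       _    = refl
      zipped (_ ∷ z) (_ ∷ ts) |≡| = cong (_ ∷_) (zipped z ts (suc-injective |≡|))

    length-word : length (word z u ts) ≡ length u + length z
    length-word = begin
      length (map toLetter (splitLetters z u ts))                    ≡⟨ List.length-map toLetter (splitLetters z u ts) ⟩
      length (map blankLetter u ++ˡ zipWith pairLetter z ts)         ≡⟨ List.length-++ (map blankLetter u) ⟩
      length (map blankLetter u) + length (zipWith pairLetter z ts)
        ≡⟨ cong₂ _+_ (List.length-map blankLetter u) (List.length-zipWith pairLetter z ts) ⟩
      length u + length z ⊓ length ts  ≡⟨ cong (λ n → length u + length z ⊓ n) |ts|≡|z| ⟩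
      length u + length z ⊓ length z   ≡⟨ cong (length u +_) (⊓-idem (length z)) ⟩
      length u + length z              ∎
      where open ≡-Reasoning

  RepT-splitLetters : Vec ℕ (d + d′) → List SplitLetter → Set
  RepT-splitLetters ms xs = ∀ k → PaddedRep (length (map toLetter xs)) (lookup (S ++ S′) k)
    (map (λ x → appendᶜ S S′ (sColumn x) (s′Column x) k) xs) (lookup ms k)

  RepT⇔RepT-splitLetters : (ms : Vec ℕ (d + d′)) (xs : List SplitLetter)
    → RepT (S ++ S′) ms (map toLetter xs) ⇔ RepT-splitLetters ms xs
  RepT⇔RepT-splitLetters ms xs = mk⇔
    (λ rep k → subst (λ p → PaddedRep _ (lookup (S ++ S′) k) p (lookup ms k)) (sym (List.map-∘ xs)) (rep k))
    (λ rep k → subst (λ p → PaddedRep _ (lookup (S ++ S′) k) p (lookup ms k)) (List.map-∘ xs) (rep k))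

  module _ (z : List (Letter S)) (u : List NonBlank) (ts : List (Tuple S′)) (|ts|≡|z| : length ts ≡ length z) where

    private
      L = length (word z u ts)
      xs = splitLetters z u ts

    word-RepT⁺ : {ns : Vec ℕ d} {n′ : Vec ℕ d′} → RepT S ns z → ColumnReps z n′ (u , ts)
               → RepT (S ++ S′) (ns ++ n′) (word z u ts)
    word-RepT⁺ {ns} {n′} rep-z reps′ = from (RepT⇔RepT-splitLetters (ns ++ n′) xs)
      (columns-appendᶜ⁺ (PaddedRep L) xs S S′ sColumn s′Column ns n′ s-reps s′-reps)
      where
      s-reps : ∀ i → PaddedRep L (lookup S i) (map (λ x → sColumn x i) xs) (lookup ns i)
      s-reps i = subst₂ (λ L′ p → PaddedRep L′ (lookup S i) p (lookup ns i))
        (sym (length-word z u ts |ts|≡|z|)) (sym (sColumn-splitLetters z u ts |ts|≡|z| i))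
        (PaddedRep-pad (length u) (length z) {A = lookup S i} (proj S i z) (List.length-map _ z) (rep-z i))
      s′-reps : ∀ j → PaddedRep L (lookup S′ j) (map (λ x → s′Column x j) xs) (lookup n′ j)
      s′-reps j = subst₂ (λ L′ p → PaddedRep L′ (lookup S′ j) p (lookup n′ j))
        (sym (length-word z u ts |ts|≡|z|)) (sym (s′Column-splitLetters z u ts |ts|≡|z| j)) (reps′ j)

    word-RepT⁻ : {ms : Vec ℕ (d + d′)} → RepT (S ++ S′) ms (word z u ts)
               → RepT S (Vec.take d ms) z × ColumnReps z (Vec.drop d ms) (u , ts)
    word-RepT⁻ {ms} rep = s-rep , s′-reps
      where
      reps = columns-appendᶜ⁻ (PaddedRep L) xs S S′ sColumn s′Column ms (to (RepT⇔RepT-splitLetters ms xs) rep)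
      s-rep : RepT S (Vec.take d ms) z
      s-rep i = PaddedRep-unpad (length u) (length z) {A = lookup S i} (proj S i z) (List.length-map _ z)
        (subst₂ (λ L′ p → PaddedRep L′ (lookup S i) p (lookup (Vec.take d ms) i))
          (length-word z u ts |ts|≡|z|) (sColumn-splitLetters z u ts |ts|≡|z| i) (proj₁ reps i))
      s′-reps : ColumnReps z (Vec.drop d ms) (u , ts)
      s′-reps j = subst₂ (λ L′ p → PaddedRep L′ (lookup S′ j) p (lookup (Vec.drop d ms) j))
        (length-word z u ts |ts|≡|z|) (s′Column-splitLetters z u ts |ts|≡|z| j) (proj₂ reps j)

  attach : (ts : List (Tuple S′)) → All IsNonBlank ts → List NonBlank
  attach []       []       = []
  attach (t ∷ ts) (p ∷ ps) = (t , p) ∷ attach ts ps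

  map-proj₁-attach : (ts : List (Tuple S′)) (ps : All IsNonBlank ts) → map proj₁ (attach ts ps) ≡ ts
  map-proj₁-attach []       []       = refl
  map-proj₁-attach (t ∷ ts) (p ∷ ps) = cong (t ∷_) (map-proj₁-attach ts ps)

  columnᵗ≡map-just⇒All-IsNonBlank : (j : Fin d′) (ts : List (Tuple S′)) (w : Word (lookup S′ j))
                                  → columnᵗ j ts ≡ map just w → All IsNonBlank ts
  columnᵗ≡map-just⇒All-IsNonBlank j []       []      _  = []
  columnᵗ≡map-just⇒All-IsNonBlank j (t ∷ ts) (x ∷ w) eq =
    just⇒anyJust (lookupᵗ t) j (List.∷-injectiveˡ eq) ∷
    columnᵗ≡map-just⇒All-IsNonBlank j ts w (List.∷-injectiveʳ eq)

  -- The S′-representations, left-padded to the common length L = |z| ⊔ max |r j|, read column by column.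
  -- The first L ∸ |z| columns form u; they are non-blank because either there are none or some r j has length L.
  module Extension (z : List (Letter S)) (n′ : Vec ℕ d′) where
    r : (j : Fin d′) → Word (lookup S′ j)
    r j = proj₁ (Representation.rep-exists (lookup S′ j) (lookup n′ j))

    M = maxᶠ (λ j → length (r j))
    L = length z ⊔ M
    k = L ∸ length z

    |r|≤L : ∀ j → length (r j) ≤ L
    |r|≤L j = ≤-trans (≤-maxᶠ (λ j → length (r j)) j) (m≤n⊔m (length z) M)

    columns : List (Tuple S′)
    columns = transpose {Ts = S′} L (λ j → padLeft L (r j))

    columnᵗ-columns : ∀ j → columnᵗ j columns ≡ padLeft L (r j)
    columnᵗ-columns = column-transpose L (λ j → padLeft L (r j))
      (λ j → trans (length-blanks++just (L ∸ length (r j)) (r j)) (m∸n+n≡m (|r|≤L j)))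

    leading-IsNonBlank : All IsNonBlank (take k columns)
    leading-IsNonBlank with M ≤? length z
    ... | yes M≤|z| = subst (λ k → All IsNonBlank (take k columns)) (sym k≡0) []
      where
      k≡0 : k ≡ 0
      k≡0 = trans (cong (_∸ length z) (m≥n⇒m⊔n≡m M≤|z|)) (n∸n≡0 (length z))
    ... | no  M≰|z| with maxᶠ-attained (λ j → length (r j))
    ...   | inj₁ M≡0          = ⊥-elim (M≰|z| (subst (_≤ length z) (sym M≡0) z≤n))
    ...   | inj₂ (j , M≡|rj|) =
      All.take⁺ k (columnᵗ≡map-just⇒All-IsNonBlank j columns (r j) (trans (columnᵗ-columns j) unpadded))
      where
      L≡|rj| : L ≡ length (r j)
      L≡|rj| = trans (m≤n⇒m⊔n≡n (<⇒≤ (≰⇒> M≰|z|))) M≡|rj|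
      unpadded : padLeft L (r j) ≡ map just (r j)
      unpadded = cong (λ a → replicate a nothing ++ˡ map just (r j))
                      (trans (cong (_∸ length (r j)) L≡|rj|) (n∸n≡0 (length (r j))))

    u : List NonBlank
    u = attach (take k columns) leading-IsNonBlank

    ts : List (Tuple S′)
    ts = drop k columns

    map-proj₁-u : map proj₁ u ≡ take k columns
    map-proj₁-u = map-proj₁-attach (take k columns) leading-IsNonBlank

    u++ts≡columns : map proj₁ u ++ˡ ts ≡ columns
    u++ts≡columns = trans (cong (_++ˡ ts) map-proj₁-u) (List.take++drop≡id k columns)

    |ts|≡|z| : length ts ≡ length z
    |ts|≡|z| = begin
      length (drop k columns) ≡⟨ List.length-drop k columns ⟩
      length columns ∸ k      ≡⟨ cong (_∸ k) (length-transpose L _) ⟩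
      L ∸ (L ∸ length z)      ≡⟨ m∸[m∸n]≡n (m≤m⊔n (length z) M) ⟩
      length z                ∎
      where open ≡-Reasoning

    |u|+|z|≡L : length u + length z ≡ L
    |u|+|z|≡L = begin
      length u + length z                  ≡⟨ cong (_+ length z) (List.length-map proj₁ u) ⟨
      length (map proj₁ u) + length z      ≡⟨ cong (λ v → length v + length z) map-proj₁-u ⟩
      length (take k columns) + length z   ≡⟨ cong (_+ length z) (List.length-take k columns) ⟩
      k ⊓ length columns + length z        ≡⟨ cong (λ n → k ⊓ n + length z) (length-transpose L _) ⟩
      k ⊓ L + length z                     ≡⟨ cong (_+ length z) (m≤n⇒m⊓n≡m (m∸n≤m L (length z))) ⟩
      k + length z                         ≡⟨ m∸n+n≡m (m≤m⊔n (length z) M) ⟩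
      L                                    ∎
      where open ≡-Reasoning

    column-reps : ColumnReps z n′ (u , ts)
    column-reps j = r j , padded , proj₂ (Representation.rep-exists (lookup S′ j) (lookup n′ j))
      where
      padded : columnᵗ j (map proj₁ u ++ˡ ts) ≡ padLeft (length u + length z) (r j)
      padded = trans (cong (columnᵗ j) u++ts≡columns)
                     (trans (columnᵗ-columns j) (cong (λ L′ → padLeft L′ (r j)) (sym |u|+|z|≡L)))

  extension : List (Letter S) → Vec ℕ d′ → List NonBlank × List (Tuple S′)
  extension z n′ = Extension.u z n′ , Extension.ts z n′

  module _ (z : List (Letter S)) (n′ : Vec ℕ d′) where

    extension-prefix-≤ : (u₁ : List NonBlank) (ts₁ : List (Tuple S′)) (u₂ : List NonBlank) (ts₂ : List (Tuple S′))
      → length ts₁ ≡ length z → ColumnReps z n′ (u₁ , ts₁) → ColumnReps z n′ (u₂ , ts₂)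
      → length u₂ ≤ length u₁
    extension-prefix-≤ u₁ ts₁ []             ts₂ _         _     _     = z≤n
    extension-prefix-≤ u₁ ts₁ ((t , p) ∷ u₂) ts₂ |ts₁|≡|z| reps₁ reps₂ = +-cancelʳ-≤ (length z) _ _
      (nonBlank-head⇒≤ (map proj₁ u₁ ++ˡ ts₁) t (map proj₁ u₂ ++ˡ ts₂)
        (trans (List.length-++ (map proj₁ u₁)) (cong₂ _+_ (List.length-map proj₁ u₁) |ts₁|≡|z|))
        p n′ reps₁ reps₂)

    extension-unique : (u₁ : List NonBlank) (ts₁ : List (Tuple S′)) (u₂ : List NonBlank) (ts₂ : List (Tuple S′))
      → length ts₁ ≡ length z → length ts₂ ≡ length z
      → ColumnReps z n′ (u₁ , ts₁) → ColumnReps z n′ (u₂ , ts₂) → (u₁ , ts₁) ≡ (u₂ , ts₂)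
    extension-unique u₁ ts₁ u₂ ts₂ |ts₁|≡|z| |ts₂|≡|z| reps₁ reps₂ =
      cong₂ _,_ (List.map-injective NonBlank-proj₁-injective (proj₁ split≡)) (proj₂ split≡)
      where
      |u₁|≡|u₂| : length u₁ ≡ length u₂
      |u₁|≡|u₂| = ≤-antisym (extension-prefix-≤ u₂ ts₂ u₁ ts₁ |ts₂|≡|z| reps₂ reps₁)
                            (extension-prefix-≤ u₁ ts₁ u₂ ts₂ |ts₁|≡|z| reps₁ reps₂)
      |pu₁|≡|pu₂| : length (map proj₁ u₁) ≡ length (map proj₁ u₂)
      |pu₁|≡|pu₂| = trans (List.length-map proj₁ u₁) (trans |u₁|≡|u₂| (sym (List.length-map proj₁ u₂)))
      |u₁++ts₁|≡|u₂++ts₂| : length (map proj₁ u₁ ++ˡ ts₁) ≡ length (map proj₁ u₂ ++ˡ ts₂)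
      |u₁++ts₁|≡|u₂++ts₂| = trans (List.length-++ (map proj₁ u₁))
        (trans (cong₂ _+_ |pu₁|≡|pu₂| (trans |ts₁|≡|z| (sym |ts₂|≡|z|)))
               (sym (List.length-++ (map proj₁ u₂))))
      columns≡ : ∀ j → columnᵗ j (map proj₁ u₁ ++ˡ ts₁) ≡ columnᵗ j (map proj₁ u₂ ++ˡ ts₂)
      columns≡ j with reps₁ j | reps₂ j
      ... | w₁ , col₁≡ , rep₁ | w₂ , col₂≡ , rep₂ = trans col₁≡ (trans
        (cong₂ padLeft (cong (_+ length z) |u₁|≡|u₂|) (Representation.Rep-functional (lookup S′ j) rep₁ rep₂))
        (sym col₂≡))
      split≡ = ++-injective-≡length (map proj₁ u₁) (map proj₁ u₂) ts₁ ts₂ |pu₁|≡|pu₂|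
                 (columnᵗ-injective _ _ |u₁++ts₁|≡|u₂++ts₂| columns≡)

-- Counting accepted words

module Counting {d d′ : ℕ} (S : Vec ANS d) (S′ : Vec ANS d′) (D : DFA (Letter (S ++ S′))) where
  open Splitting S S′
  open DFA D renaming (nstates to N)

  δᵇ : Fin N → NonBlank → Fin N
  δᵇ q x = δ q (toLetter (blankLetter x))

  open ReachingWords _≟ⁿᵇ_ allNonBlank ∈-allNonBlank δᵇ start using (run; Reaches; reachingCard)
  open Words (allTuples S′) ∈-allTuples
    using (wordsOfLength; ∈-wordsOfLength; ∈-wordsOfLength⇒length; wordsOfLength-unique)

  runPaired : List (Letter S) → Fin N → List (Tuple S′) → Fin N
  runPaired z i ts = foldl δ i (map toLetter (zipWith pairLetter z ts))

  run-word : ∀ z u ts → foldl δ start (word z u ts) ≡ runPaired z (run start u) ts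
  run-word z u ts = begin
    foldl δ start (map toLetter (map blankLetter u ++ˡ zipWith pairLetter z ts))
      ≡⟨ cong (foldl δ start) (List.map-++ toLetter (map blankLetter u) _) ⟩
    foldl δ start (map toLetter (map blankLetter u) ++ˡ map toLetter (zipWith pairLetter z ts))
      ≡⟨ List.foldl-++ δ start (map toLetter (map blankLetter u)) _ ⟩
    runPaired z (foldl δ start (map toLetter (map blankLetter u))) ts
      ≡⟨ cong (λ q → runPaired z q ts) (cong (foldl δ start) (List.map-∘ u)) ⟨
    runPaired z (foldl δ start (map (λ x → toLetter (blankLetter x)) u)) ts
      ≡⟨ cong (λ q → runPaired z q ts) (List.foldl-map δ _ start u) ⟩
    runPaired z (run start u) ts
      ∎
    where open ≡-Reasoning

  λ∞ : Fin N → ℕ∞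
  λ∞ i = proj₁ (reachingCard i)

  stepMatrix : Letter S → Matℕ N
  stepMatrix a i k = ∑ˡ (λ t → kronecker (δ i (toLetter (pairLetter a t))) k) (allTuples S′)

  γ : Fin N → ℕ
  γ j = iverson (final j)

  pathCount : List (Letter S) → Matℕ N
  pathCount z i j = ∑ˡ (λ ts → kronecker (runPaired z i ts) j) (wordsOfLength (length z))

  acceptCount : List (Letter S) → Fin N → ℕ
  acceptCount z i = length (filter (λ ts → T? (final (runPaired z i ts))) (wordsOfLength (length z)))

  pathCount-∷ : ∀ a z i j → pathCount (a ∷ z) i j ≡ ∑ℕ (λ k → stepMatrix a i k * pathCount z k j)
  pathCount-∷ a z i j = sym (begin
    ∑ℕ (λ k → ∑ˡ (λ t → kronecker (next t) k) (allTuples S′) * pathCount z k j)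
      ≡⟨ ∑ℕ-cong (λ k → ∑ˡ-*ʳ (λ t → kronecker (next t) k) (pathCount z k j) (allTuples S′)) ⟩
    ∑ℕ (λ k → ∑ˡ (λ t → kronecker (next t) k * pathCount z k j) (allTuples S′))
      ≡⟨ ∑-∑ˡ-comm (λ t k → kronecker (next t) k * pathCount z k j) (allTuples S′) ⟩
    ∑ˡ (λ t → ∑ℕ (λ k → kronecker (next t) k * pathCount z k j)) (allTuples S′)
      ≡⟨ ∑ˡ-cong (allTuples S′) (λ t → ∑-kronecker (next t) (λ k → pathCount z k j)) ⟩
    ∑ˡ (λ t → pathCount z (next t) j) (allTuples S′)
      ≡⟨ ∑ˡ-cartesianProductWith (λ ts → kronecker (runPaired (a ∷ z) i ts) j) _∷_ (allTuples S′) _ ⟨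
    pathCount (a ∷ z) i j
      ∎)
    where
    open ≡-Reasoning
    next : Tuple S′ → Fin N
    next t = δ i (toLetter (pairLetter a t))

  μ*ℕ-stepMatrix : ∀ z i j → μ*ℕ stepMatrix z i j ≡ pathCount z i j
  μ*ℕ-stepMatrix = μ*ℕ-unique stepMatrix pathCount (λ i j → +-identityʳ (kronecker i j)) pathCount-∷

  acceptCount≡ : ∀ z i → acceptCount z i ≡ ∑ℕ (λ j → pathCount z i j * γ j)
  acceptCount≡ z i = begin
    acceptCount z i
      ≡⟨ length-filter≡∑ˡ (λ ts → T? (final (runPaired z i ts))) words ⟩
    ∑ˡ (λ ts → γ (runPaired z i ts)) words
      ≡⟨ ∑ˡ-cong words (λ ts → ∑-kronecker (runPaired z i ts) γ) ⟨
    ∑ˡ (λ ts → ∑ℕ (λ j → kronecker (runPaired z i ts) j * γ j)) words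
      ≡⟨ ∑-∑ˡ-comm (λ ts j → kronecker (runPaired z i ts) j * γ j) words ⟨
    ∑ℕ (λ j → ∑ˡ (λ ts → kronecker (runPaired z i ts) j * γ j) words)
      ≡⟨ ∑ℕ-cong (λ j → ∑ˡ-*ʳ (λ ts → kronecker (runPaired z i ts) j) (γ j) words) ⟨
    ∑ℕ (λ j → pathCount z i j * γ j)
      ∎
    where
    open ≡-Reasoning
    words = wordsOfLength (length z)

  weight : List (Letter S) → ℕ∞
  weight z = ∑∞ (λ i → λ∞ i *∞ fin (acceptCount z i))

  μ∞ : Letter S → Matrices.Mat ℕ∞-rawSemiring N
  μ∞ a i k = fin (stepMatrix a i k)

  γ∞ : Fin N → ℕ∞
  γ∞ j = fin (γ j)

  sandwich∞≡weight : ∀ z → Matrices.sandwich ℕ∞-rawSemiring λ∞ (μ*∞ μ∞ z) γ∞ ≡ weight z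
  sandwich∞≡weight z = begin
    Matrices.sandwich ℕ∞-rawSemiring λ∞ (μ*∞ μ∞ z) γ∞
      ≡⟨ ∑-cong ℕ∞-rawSemiring (λ i → ∑-cong ℕ∞-rawSemiring (λ j →
           cong (λ v → λ∞ i *∞ (v *∞ γ∞ j)) (trans (μ*∞-fin stepMatrix z i j) (cong fin (μ*ℕ-stepMatrix z i j))))) ⟩
    Matrices.sandwich ℕ∞-rawSemiring λ∞ (λ i j → fin (pathCount z i j)) γ∞
      ≡⟨ sandwich∞-fin λ∞ (pathCount z) γ ⟩
    ∑∞ (λ i → λ∞ i *∞ fin (∑ℕ (λ j → pathCount z i j * γ j)))
      ≡⟨ ∑-cong ℕ∞-rawSemiring (λ i → cong (λ c → λ∞ i *∞ fin c) (acceptCount≡ z i)) ⟨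
    weight z
      ∎
    where open ≡-Reasoning

  λℕ : Fin N → ℕ
  λℕ i = ℕ∞-truncate (λ∞ i)

  sandwichℕ≡ : ∀ z → Matrices.sandwich ℕ-rawSemiring λℕ (μ*ℕ stepMatrix z) γ
                   ≡ ∑ℕ (λ i → λℕ i * acceptCount z i)
  sandwichℕ≡ z = trans (sandwichℕ λℕ (μ*ℕ stepMatrix z) γ) (∑ℕ-cong (λ i → cong (λℕ i *_)
    (trans (∑ℕ-cong (λ j → cong (_* γ j) (μ*ℕ-stepMatrix z i j))) (sym (acceptCount≡ z i)))))

  Accepted : List (Letter S) → List NonBlank × List (Tuple S′) → Set
  Accepted z (u , ts) = length ts ≡ length z × Accepts D (word z u ts)

  Accepted? : ∀ z → Decidable (Accepted z)
  Accepted? z (u , ts) = (length ts ≟ length z) ×-dec T? (final (foldl δ start (word z u ts)))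

  AcceptingFrom : List (Letter S) → Fin N → List (Tuple S′) → Set
  AcceptingFrom z i ts = length ts ≡ length z × T (final (runPaired z i ts))

  AcceptingFrom-card : ∀ z i → FinCard (AcceptingFrom z i) (acceptCount z i)
  AcceptingFrom-card z i =
    filter accepting? words , refl ,
    Unique.filter⁺ accepting? (wordsOfLength-unique (allTuples-unique S′) (length z)) ,
    λ ts → mk⇔
      (λ (|ts|≡|z| , acc) →
         ∈-filter⁺ accepting? (subst (λ n → ts ∈ wordsOfLength n) |ts|≡|z| (∈-wordsOfLength ts)) acc)
      (λ ts∈ → let ts∈words , acc = ∈-filter⁻ accepting? {xs = words} ts∈
               in ∈-wordsOfLength⇒length (length z) ts∈words , acc)
    where
    words = wordsOfLength (length z)
    accepting? = λ ts → T? (final (runPaired z i ts))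

  pair-≟ : DecidableEquality (List NonBlank × List (Tuple S′))
  pair-≟ = Product.≡-dec (List.≡-dec _≟ⁿᵇ_) (List.≡-dec _≟ᵗ_)

  -- Splitting at the state reached after the blank prefix makes Accepted z a disjoint union of products.
  Accepted-card : ∀ z → HasCard (Accepted z) (weight z)
  Accepted-card z = HasCard-resp-⇔ via-state
    (HasCard-∑ pair-≟ ReachingAccepting ReachingAccepting?
      (λ i j _ (reachᵢ , _) (reachⱼ , _) → trans (sym reachᵢ) reachⱼ)
      (λ i → λ∞ i *∞ fin (acceptCount z i))
      (λ i → HasCard-× (List.≡-dec _≟ⁿᵇ_) (λ u → run start u Fin.≟ i) (proj₂ (reachingCard i))
                       (AcceptingFrom-card z i)))
    where
    ReachingAccepting : Fin N → List NonBlank × List (Tuple S′) → Set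
    ReachingAccepting i (u , ts) = Reaches i u × AcceptingFrom z i ts
    ReachingAccepting? : ∀ i → Decidable (ReachingAccepting i)
    ReachingAccepting? i (u , ts) =
      (run start u Fin.≟ i) ×-dec ((length ts ≟ length z) ×-dec T? (final (runPaired z i ts)))
    via-state : ∀ p → (Σ (Fin N) λ i → ReachingAccepting i p) ⇔ Accepted z p
    via-state (u , ts) = mk⇔
      (λ (i , reaches , |ts|≡|z| , acc) → |ts|≡|z| ,
         subst (λ q → T (final q)) (sym (trans (run-word z u ts) (cong (λ q → runPaired z q ts) reaches))) acc)
      (λ (|ts|≡|z| , acc) → run start u , refl , |ts|≡|z| , subst (λ q → T (final q)) (run-word z u ts) acc)

module Fibres {d d′ : ℕ} (S : Vec ANS d) (S′ : Vec ANS d′) (X : Vec ℕ (d + d′) → Set)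
  (D : DFA (Letter (S ++ S′)))
  (D-recognizes : (w : List (Letter (S ++ S′)))
                → (Σ (Vec ℕ (d + d′)) λ ms → RepT (S ++ S′) ms w × X ms) ⇔ Accepts D w) where
  open Splitting S S′
  open Counting S S′ D

  Accepted-rep : ∀ z p → Accepted z p
    → Σ (Vec ℕ (d + d′)) λ ms → RepT S (Vec.take d ms) z × ColumnReps z (Vec.drop d ms) p × X ms
  Accepted-rep z (u , ts) (|ts|≡|z| , acc) =
    let ms , rep , x = from (D-recognizes (word z u ts)) acc
        rep-z , reps′ = word-RepT⁻ z u ts |ts|≡|z| rep
    in ms , rep-z , reps′ , x

  fibre-card : ∀ z ns → RepT S ns z → HasCard (λ n′ → X (ns ++ n′)) (weight z)
  fibre-card z ns rep-z =
    HasCard-via-bijection pair-≟ (Accepted? z) (extension z) accepted injective surjective (Accepted-card z)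
    where
    accepted : ∀ n′ → X (ns ++ n′) → Accepted z (extension z n′)
    accepted n′ x = let open Extension z n′ in |ts|≡|z| ,
      to (D-recognizes _) (ns ++ n′ , word-RepT⁺ z u ts |ts|≡|z| {ns} {n′} rep-z column-reps , x)
    injective : ∀ n₁ n₂ → X (ns ++ n₁) → X (ns ++ n₂) → extension z n₁ ≡ extension z n₂ → n₁ ≡ n₂
    injective n₁ n₂ _ _ same = lookup-injective n₁ n₂ (λ j → PaddedRep-injective {A = lookup S′ j}
      (Extension.column-reps z n₁ j) (subst (ColumnReps z n₂) (sym same) (Extension.column-reps z n₂) j))
    surjective : ∀ p → Accepted z p → Σ (Vec ℕ d′) λ n′ → X (ns ++ n′) × extension z n′ ≡ p
    surjective (u , ts) accepted-p@(|ts|≡|z| , _) with Accepted-rep z (u , ts) accepted-p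
    ... | ms , rep-z′ , reps′ , x = n′ , subst X ms≡ x ,
      extension-unique z n′ _ _ u ts (Extension.|ts|≡|z| z n′) |ts|≡|z| (Extension.column-reps z n′) reps′
      where
      n′ = Vec.drop d ms
      ms≡ : ms ≡ ns ++ n′
      ms≡ = trans (sym (Vec.take++drop≡id d ms)) (cong (_++ n′) (RepT-injective {Ts = S} rep-z′ rep-z))

  Accepted-empty : ∀ z → ¬ (Σ (Vec ℕ d) λ ns → RepT S ns z) → HasCard (Accepted z) (fin 0)
  Accepted-empty z ¬rep = FinCard-empty λ p accepted →
    let ms , rep-z , _ = Accepted-rep z p accepted in ¬rep (Vec.take d ms , rep-z)

theorem7p8 : {d d′ : ℕ} (S : Vec ANS d) (S′ : Vec ANS d′) → 1 ≤ d → 1 ≤ d′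
    → (X : Vec ℕ (d + d′) → Set) → Recognizable (S ++ S′) X
    → (f : Vec ℕ d → ℕ∞)
    → ((ns : Vec ℕ d) → HasCard (λ ns′ → X (ns ++ ns′)) (f ns))
    → Regular ℕ∞-rawSemiring S f
      × ((g : Vec ℕ d → ℕ) → ((ns : Vec ℕ d) → f ns ≡ fin (g ns))
         → Regular ℕ-rawSemiring S g)
theorem7p8 S S′ _ _ X (D , D-recognizes) f card-f = regular∞ , regularℕ
  where
  open Counting S S′ D
  open Fibres S S′ X D D-recognizes

  f≡weight : ∀ z ns → RepT S ns z → f ns ≡ weight z
  f≡weight z ns rep = HasCard-unique (card-f ns) (fibre-card z ns rep)

  weight≡0 : ∀ z → ¬ (Σ (Vec ℕ _) λ ns → RepT S ns z) → weight z ≡ fin 0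
  weight≡0 z ¬rep = HasCard-unique (Accepted-card z) (Accepted-empty z ¬rep)

  regular∞ : Regular ℕ∞-rawSemiring S f
  regular∞ = _ , μ∞ , λ∞ , γ∞ , λ z →
    (λ ns rep → trans (sandwich∞≡weight z) (sym (f≡weight z ns rep))) ,
    (λ ¬rep → trans (sandwich∞≡weight z) (weight≡0 z ¬rep))

  regularℕ : (g : Vec ℕ _ → ℕ) → ((ns : Vec ℕ _) → f ns ≡ fin (g ns)) → Regular ℕ-rawSemiring S g
  regularℕ g f≡g = _ , stepMatrix , λℕ , γ , λ z →
    (λ ns rep → trans (sandwichℕ≡ z) (truncate-weight z (trans (sym (f≡weight z ns rep)) (f≡g ns)))) ,
    (λ ¬rep → trans (sandwichℕ≡ z) (truncate-weight z (weight≡0 z ¬rep)))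
    where
    truncate-weight : ∀ z {n} → weight z ≡ fin n → ∑ℕ (λ i → λℕ i * acceptCount z i) ≡ n
    truncate-weight z = finite-∑∞⇒∑ℕ-truncate λ∞ (acceptCount z)
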